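{- Let $T$ be a tree on $n\geq 4$ vertices that is not a path, and let $M=(T)_{\mathrm{res}}$ be the matroid on ground set $V(T)$ whose independent sets are the subsets of minimal resolving sets of $T$. Then a subset $H\subseteq V(T)$ is a hyperplane of $M$ if and only if $H = V(T)\setminus (X_1\cup X_2)$, where $X_1, X_2$ are the vertex sets of two distinct legs at the same exterior major vertex of $T$.
   Context: For a connected graph $G$, $d(u,v)$ is the shortest-path distance. $R\subseteq V(G)$ is a resolving set if for any two distinct vertices $u,w$ there is $h\in R$ with $d(u,h)\neq d(w,h)$; it is minimal if no proper subset is resolving. For a tree $T$ and a vertex $v$ with $\deg(v)\ge 3$, a leg (branch path) at $v$ is a connected component of $T-v$ that is a path, exactly one of whose vertices is adjacent to $v$, that vertex being an endpoint of the path; $v$ is an exterior major vertex if $\deg(v)\ge 3$ and there is at least one leg at $v$. Known fact (Slater): a set $S$ is a minimal resolving set of a tree (not a path) iff for each exterior major vertex $v$, $S$ contains exactly one vertex from each of all but exactly one of the legs at $v$, and no other vertices. The rank $r(X)$ of $X\subseteq V(T)$ is the maximum size of an independent set contained in $X$; a flat is a set $F$ with $r(F)<r(F\cup\{x\})$ for all $x\notin F$; a hyperplane is a flat $H$ with $r(H)=r(V(T))-1$. -}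

module Defs where

open import Data.Bool using (Bool; T)
open import Data.Nat using (ℕ; zero; suc; _+_; _≤_; _<_)
open import Data.Fin using (Fin; zero; suc; toℕ; inject₁; fromℕ)
open import Data.Fin.Subset using (Subset; _∈_; _∉_; _⊆_; _⊂_; ∣_∣; ⁅_⁆; _∪_; ∁; ⊤)
open import Data.Vec using (tabulate)
open import Data.Product using (Σ; ∃; _×_; _,_)
open import Data.Sum using (_⊎_)
open import Function.Bundles using (_⇔_)
open import Function.Definitions using (Injective)
open import Relation.Binary.PropositionalEquality using (_≡_; _≢_)
open import Relation.Nullary using (¬_)

Graph : ℕ → Set
Graph n = Fin n → Fin n → Bool

module _ {n : ℕ} (G : Graph n) where

  Adj : Fin n → Fin n → Set
  Adj u v = T (G u v)

  data Walk : Fin n → Fin n → ℕ → Set where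
    here : ∀ {u} → Walk u u 0
    step : ∀ {u v w k} → Adj u v → Walk v w k → Walk u w (suc k)

  Dist : Fin n → Fin n → ℕ → Set
  Dist u v k = Walk u v k × (∀ m → Walk u v m → k ≤ m)

  Connected : Set
  Connected = ∀ u v → ∃ λ k → Walk u v k

  HasCycle : Set
  HasCycle = ∃ λ k → Σ (Fin (suc (suc (suc k))) → Fin n) λ p →
    Injective _≡_ _≡_ p ×
    (∀ (i : Fin (suc (suc k))) → Adj (p (inject₁ i)) (p (suc i))) ×
    Adj (p (fromℕ (suc (suc k)))) (p zero)

  IsTree : Set
  IsTree = (∀ u v → Adj u v → Adj v u) × (∀ u → ¬ Adj u u) × Connected × ¬ HasCycle

  -- The induced subgraph on L is a path p0 - p1 - ... - pk, with the given
  -- enumeration p of L.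
  PathEnum : Subset n → (k : ℕ) → (Fin (suc k) → Fin n) → Set
  PathEnum L k p =
    Injective _≡_ _≡_ p ×
    (∀ x → x ∈ L ⇔ (∃ λ i → p i ≡ x)) ×
    (∀ i j → Adj (p i) (p j) ⇔ (suc (toℕ i) ≡ toℕ j ⊎ suc (toℕ j) ≡ toℕ i))

  IsPathOn : Subset n → Set
  IsPathOn L = ∃ λ k → Σ (Fin (suc k) → Fin n) λ p → PathEnum L k p

  IsPathGraph : Set
  IsPathGraph = IsPathOn ⊤

  deg : Fin n → ℕ
  deg v = ∣ tabulate (λ u → G v u) ∣

  -- L is a leg at v: a connected component of T - v (v ∉ L, L is closed under
  -- adjacency in T - v, L is connected since it induces a path) which is a path
  -- p0 ... pk, whose only vertex adjacent to v is the endpoint p0.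
  Leg : Fin n → Subset n → Set
  Leg v L =
    v ∉ L ×
    (∀ x y → x ∈ L → Adj x y → y ≢ v → y ∈ L) ×
    (∃ λ k → Σ (Fin (suc k) → Fin n) λ p →
       PathEnum L k p × (∀ x → x ∈ L → (Adj v x ⇔ x ≡ p zero)))

  ExteriorMajor : Fin n → Set
  ExteriorMajor v = 3 ≤ deg v × ∃ (λ L → Leg v L)

  Resolving : Subset n → Set
  Resolving R = ∀ u w → u ≢ w → ∃ λ h → h ∈ R ×
    ∃ λ a → ∃ λ b → Dist u h a × Dist w h b × a ≢ b

  MinimalResolving : Subset n → Set
  MinimalResolving R = Resolving R × (∀ S → S ⊂ R → ¬ Resolving S)

  Independent : Subset n → Set
  Independent I = ∃ λ R → MinimalResolving R × I ⊆ R

  Rank : Subset n → ℕ → Set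
  Rank X r = (∃ λ I → I ⊆ X × Independent I × ∣ I ∣ ≡ r) ×
             (∀ I → I ⊆ X → Independent I → ∣ I ∣ ≤ r)

  Flat : Subset n → Set
  Flat F = ∀ x → x ∉ F → ∀ r s → Rank F r → Rank (F ∪ ⁅ x ⁆) s → r < s

  Hyperplane : Subset n → Set
  Hyperplane H = Flat H × ∃ λ r → Rank H r × Rank ⊤ (suc r)

-- Slater: S resolves T iff at every exterior major vertex v, S meets one of any two legs at v
-- (the heads of two unmet legs are equidistant from S; conversely, the middle of a geodesic
-- between two unresolved vertices would carry two unmet legs, or T would be a path). Hence the
-- independent sets of (T)_res are the sets lying in legs, with at most one vertex per leg and
-- missing some leg at every exterior major vertex. Deleting two legs at v therefore lowers the
-- rank by exactly one, and any of their vertices restores it. Conversely, exchanging the vertex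
-- y ∉ H of a maximal independent set for a vertex of H shows that every y ∉ H lies on one of two
-- legs at a vertex that both miss H, and two such vertices on different leg pairs would raise
-- r(V) by two.

module Submission where

open import Data.Bool using (Bool; T; not; _∧_)
open import Data.Bool.Properties using (T?; T-≡; T-∧)
open import Data.Empty using (⊥; ⊥-elim)
open import Data.Fin using (Fin; zero; suc; toℕ; inject₁; fromℕ; fromℕ<)
import Data.Fin.Properties as FP
open FP using (any?; all?; injective⇒≤; toℕ-injective; toℕ<n; toℕ-fromℕ<; fromℕ<-toℕ; toℕ-fromℕ; toℕ-inject₁)
open import Data.Fin.Subset as Subset using (Subset; _∈_; _∉_; _⊆_; _⊂_; ∣_∣; ⁅_⁆; _∪_; _-_; ∁; ⊤; inside; outside; Nonempty)
open import Data.Fin.Subset.Properties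
  using (_∈?_; _⊆?_; anySubset?; nonempty?; Empty-unique; ⊆-antisym; p⊂q⇒∣p∣<∣q∣; ∣p∣≤n; ∣⊥∣≡0; ∉⊥; ∈⊤;
         x∈⁅x⁆; x∈⁅y⁆⇒x≡y; x∈p∪q⁺; x∈p∪q⁻; x∈∁p⇒x∉p; x∉p⇒x∈∁p; p─⊥≡p; p─q⊆p; x∈p∧x≢y⇒x∈p-y)
open import Data.Nat using (ℕ; zero; suc; _+_; _≤_; _<_; z≤n; s≤s)
import Data.Nat.Properties as ℕP
open ℕP using (≤-refl; ≤-trans; <-trans; n<1+n; ≤-antisym; m≤m+n; +-suc; <⇒≢; ≤-pred; _≤?_; n≤1+n; +-mono-≤; +-monoʳ-≤; +-monoˡ-≤; +-monoʳ-<)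
open import Data.Product using (Σ; ∃; ∃₂; _×_; _,_; proj₁; proj₂)
open import Data.Sum using (_⊎_; inj₁; inj₂; [_,_])
import Data.Sum
open import Data.Vec using (_∷_; tabulate; here; there)
open import Data.Vec.Properties using (lookup∘tabulate; []=⇒lookup; lookup⇒[]=)
open import Function.Base using (_∘_; id)
open import Function.Bundles using (_⇔_; mk⇔; Equivalence)
open Equivalence using (to; from)
open import Function.Definitions using (Injective)
open import Relation.Binary using (tri<; tri≈; tri>)
open import Relation.Binary.PropositionalEquality using (_≡_; _≢_; refl; sym; trans; cong; cong₂; subst; subst₂; ≢-sym; module ≡-Reasoning)
open import Relation.Nullary using (¬_; Dec; yes; no)
open import Relation.Nullary.Decidable using (⌊_⌋; toWitness; fromWitness; toWitnessFalse; fromWitnessFalse; ¬?; _×-dec_; _⊎-dec_; _→-dec_; map′)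
open import Relation.Unary using (Decidable)

open import Defs

private variable n : ℕ

∈-tabulate⇔ : (f : Fin n → Bool) {x : Fin n} → x ∈ tabulate f ⇔ T (f x)
∈-tabulate⇔ f {x} = mk⇔
  (λ x∈ → from T-≡ (trans (sym (lookup∘tabulate f x)) ([]=⇒lookup x∈)))
  (λ t → lookup⇒[]= x _ (trans (lookup∘tabulate f x) (to T-≡ t)))

opaque
  ⟦_⟧ : {P : Fin n → Set} → Decidable P → Subset n
  ⟦ P? ⟧ = tabulate (λ x → ⌊ P? x ⌋)

  ∈⟦⟧⁺ : {P : Fin n → Set} (P? : Decidable P) {x : Fin n} → P x → x ∈ ⟦ P? ⟧
  ∈⟦⟧⁺ P? px = from (∈-tabulate⇔ _) (fromWitness px)

  ∈⟦⟧⁻ : {P : Fin n → Set} (P? : Decidable P) {x : Fin n} → x ∈ ⟦ P? ⟧ → P x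
  ∈⟦⟧⁻ P? x∈ = toWitness (to (∈-tabulate⇔ _) x∈)

x∈p-y⇒x≢y : ∀ {p : Subset n} {x y} → x ∈ p - y → x ≢ y
x∈p-y⇒x≢y {p = _ ∷ p} {zero} {zero} ()
x∈p-y⇒x≢y {p = _ ∷ p} {suc x} {suc y} (there x∈) refl = x∈p-y⇒x≢y {p = p} x∈ refl
x∈p-y⇒x≢y {p = _ ∷ p} {zero} {suc y} _ ()
x∈p-y⇒x≢y {p = _ ∷ p} {suc x} {zero} _ ()

x∈p-y⇒x∈p : ∀ {p : Subset n} {x y} → x ∈ p - y → x ∈ p
x∈p-y⇒x∈p {p = p} {y = y} = p─q⊆p p ⁅ y ⁆

x∈p⇒∣p∣≡1+∣p-x∣ : ∀ {p : Subset n} {x} → x ∈ p → ∣ p ∣ ≡ suc ∣ p - x ∣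
x∈p⇒∣p∣≡1+∣p-x∣ {p = inside ∷ p} {zero} here = cong suc (cong ∣_∣ (sym (p─⊥≡p p)))
x∈p⇒∣p∣≡1+∣p-x∣ {p = inside ∷ p} {suc x} (there x∈) = cong suc (x∈p⇒∣p∣≡1+∣p-x∣ x∈)
x∈p⇒∣p∣≡1+∣p-x∣ {p = outside ∷ p} {suc x} (there x∈) = x∈p⇒∣p∣≡1+∣p-x∣ x∈

x∈p∪⁅y⁆⁻ : ∀ (p : Subset n) {x y} → x ∈ p ∪ ⁅ y ⁆ → x ∈ p ⊎ x ≡ y
x∈p∪⁅y⁆⁻ p {y = y} x∈ = Data.Sum.map₂ (x∈⁅y⁆⇒x≡y y) (x∈p∪q⁻ p ⁅ y ⁆ x∈)

x∈p⇒x∈p∪⁅y⁆ : ∀ {p : Subset n} {x y} → x ∈ p → x ∈ p ∪ ⁅ y ⁆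
x∈p⇒x∈p∪⁅y⁆ x∈ = x∈p∪q⁺ (inj₁ x∈)

y∈p∪⁅y⁆ : ∀ (p : Subset n) y → y ∈ p ∪ ⁅ y ⁆
y∈p∪⁅y⁆ p y = x∈p∪q⁺ (inj₂ (x∈⁅x⁆ y))

x∉p⇒∣p∪⁅x⁆∣≡1+∣p∣ : ∀ {p : Subset n} {x} → x ∉ p → ∣ p ∪ ⁅ x ⁆ ∣ ≡ suc ∣ p ∣
x∉p⇒∣p∪⁅x⁆∣≡1+∣p∣ {p = p} {x} x∉p = trans (x∈p⇒∣p∣≡1+∣p-x∣ (y∈p∪⁅y⁆ p x)) (cong (suc ∘ ∣_∣) p∪⁅x⁆-x≡p)
  where
  p∪⁅x⁆-x≡p : (p ∪ ⁅ x ⁆) - x ≡ p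
  p∪⁅x⁆-x≡p = ⊆-antisym
    (λ z∈ → [ id , (λ z≡x → ⊥-elim (x∈p-y⇒x≢y z∈ z≡x)) ] (x∈p∪⁅y⁆⁻ p (x∈p-y⇒x∈p z∈)))
    (λ z∈ → x∈p∧x≢y⇒x∈p-y (x∈p⇒x∈p∪⁅y⁆ z∈) (λ z≡x → x∉p (subst (_∈ p) z≡x z∈)))

∣p∣>0⇒nonempty : ∀ {n} (p : Subset n) → 0 < ∣ p ∣ → Nonempty p
∣p∣>0⇒nonempty {n} p ∣p∣>0 with nonempty? p
... | yes ne = ne
... | no ¬ne = ⊥-elim (ℕP.<⇒≢ ∣p∣>0 (sym (trans (cong ∣_∣ (Empty-unique ¬ne)) (∣⊥∣≡0 n))))

x∈p∧k<∣p∣⇒k≤∣p-x∣ : ∀ {p : Subset n} {x k} → x ∈ p → k < ∣ p ∣ → k ≤ ∣ p - x ∣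
x∈p∧k<∣p∣⇒k≤∣p-x∣ x∈ k<∣p∣ = ℕP.≤-pred (subst (_ <_) (x∈p⇒∣p∣≡1+∣p-x∣ x∈) k<∣p∣)

Distinct₃ : (Fin n → Set) → Fin n → Fin n → Fin n → Set
Distinct₃ P a b c = P a × P b × P c × a ≢ b × a ≢ c × b ≢ c

ThreeDistinct : (Fin n → Set) → Set
ThreeDistinct P = ∃₂ λ a b → ∃ λ c → Distinct₃ P a b c

3≤∣p∣⇒threeDistinct : (p : Subset n) → 3 ≤ ∣ p ∣ → ThreeDistinct (_∈ p)
3≤∣p∣⇒threeDistinct p 3≤∣p∣ with ∣p∣>0⇒nonempty p (≤-trans (s≤s z≤n) 3≤∣p∣)
... | a , a∈ with ∣p∣>0⇒nonempty (p - a) (≤-trans (s≤s z≤n) (x∈p∧k<∣p∣⇒k≤∣p-x∣ a∈ 3≤∣p∣))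
... | b , b∈ with ∣p∣>0⇒nonempty (p - a - b) (x∈p∧k<∣p∣⇒k≤∣p-x∣ b∈ (x∈p∧k<∣p∣⇒k≤∣p-x∣ a∈ 3≤∣p∣))
... | c , c∈ =
  a , b , c , a∈ , x∈p-y⇒x∈p b∈ , x∈p-y⇒x∈p (x∈p-y⇒x∈p c∈) ,
  (λ a≡b → x∈p-y⇒x≢y b∈ (sym a≡b)) , (λ a≡c → x∈p-y⇒x≢y (x∈p-y⇒x∈p c∈) (sym a≡c)) ,
  (λ b≡c → x∈p-y⇒x≢y c∈ (sym b≡c))

threeDistinct⇒3≤∣p∣ : (p : Subset n) → ThreeDistinct (_∈ p) → 3 ≤ ∣ p ∣
threeDistinct⇒3≤∣p∣ p (a , b , c , a∈ , b∈ , c∈ , a≢b , a≢c , b≢c) = begin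
  3                                  ≤⟨ s≤s (s≤s (s≤s z≤n)) ⟩
  suc (suc (suc ∣ p - a - b - c ∣))  ≡⟨ cong (2 +_) (x∈p⇒∣p∣≡1+∣p-x∣ c∈p-a-b) ⟨
  suc (suc ∣ p - a - b ∣)            ≡⟨ cong suc (x∈p⇒∣p∣≡1+∣p-x∣ b∈p-a) ⟨
  suc ∣ p - a ∣                      ≡⟨ x∈p⇒∣p∣≡1+∣p-x∣ a∈ ⟨
  ∣ p ∣                              ∎
  where
  open ℕP.≤-Reasoning
  b∈p-a : b ∈ p - a
  b∈p-a = x∈p∧x≢y⇒x∈p-y b∈ (λ b≡a → a≢b (sym b≡a))
  c∈p-a-b : c ∈ p - a - b
  c∈p-a-b = x∈p∧x≢y⇒x∈p-y (x∈p∧x≢y⇒x∈p-y c∈ (λ c≡a → a≢c (sym c≡a))) (λ c≡b → b≢c (sym c≡b))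

∣p∣≤∣q∣-by-injection : (R : Fin n → Fin n → Set) (p q : Subset n) →
  (∀ x → x ∈ p → ∃ λ t → t ∈ q × R x t) →
  (∀ x x′ t → x ∈ p → x′ ∈ p → R x t → R x′ t → x ≡ x′) → ∣ p ∣ ≤ ∣ q ∣
∣p∣≤∣q∣-by-injection R p q into injective = go ∣ p ∣ p q refl into injective
  where
  go : ∀ k (p q : Subset _) → ∣ p ∣ ≡ k → (∀ x → x ∈ p → ∃ λ t → t ∈ q × R x t) →
       (∀ x x′ t → x ∈ p → x′ ∈ p → R x t → R x′ t → x ≡ x′) → k ≤ ∣ q ∣
  go zero p q _ _ _ = z≤n
  go (suc k) p q ∣p∣≡1+k into injective
    with ∣p∣>0⇒nonempty p (subst (0 <_) (sym ∣p∣≡1+k) (s≤s z≤n))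
  ... | x₀ , x₀∈p with into x₀ x₀∈p
  ... | t₀ , t₀∈q , Rx₀t₀ =
    subst (suc k ≤_) (sym (x∈p⇒∣p∣≡1+∣p-x∣ t₀∈q))
      (s≤s (go k (p - x₀) (q - t₀) (ℕP.suc-injective (trans (sym (x∈p⇒∣p∣≡1+∣p-x∣ x₀∈p)) ∣p∣≡1+k))
              into′ (λ x x′ t x∈ x′∈ → injective x x′ t (x∈p-y⇒x∈p x∈) (x∈p-y⇒x∈p x′∈))))
    where
    into′ : ∀ x → x ∈ p - x₀ → ∃ λ t → t ∈ q - t₀ × R x t
    into′ x x∈ with into x (x∈p-y⇒x∈p x∈)
    ... | t , t∈q , Rxt = t , x∈p∧x≢y⇒x∈p-y t∈q t≢t₀ , Rxt
      where
      t≢t₀ : t ≢ t₀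
      t≢t₀ refl = x∈p-y⇒x≢y x∈ (injective x x₀ t (x∈p-y⇒x∈p x∈) x₀∈p Rxt Rx₀t₀)

+-squeeze : ∀ {a b i j} → a ≤ i → b ≤ j → i + j ≤ a + b → a ≡ i × b ≡ j
+-squeeze {a} {b} {i} {j} a≤i b≤j i+j≤a+b =
  ≤-antisym a≤i (ℕP.+-cancelʳ-≤ j i a (≤-trans i+j≤a+b (+-monoʳ-≤ a b≤j))) ,
  ≤-antisym b≤j (ℕP.+-cancelˡ-≤ i j b (≤-trans i+j≤a+b (+-monoˡ-≤ b a≤i)))

even⊎odd : ∀ k → ∃ λ j → k ≡ j + j ⊎ k ≡ suc (j + j)
even⊎odd zero = 0 , inj₁ refl
even⊎odd (suc k) with even⊎odd k
... | j , inj₁ k≡2j = j , inj₂ (cong suc k≡2j)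
... | j , inj₂ k≡2j+1 = suc j , inj₁ (trans (cong suc k≡2j+1) (cong suc (sym (+-suc j j))))

-- The vertex set stays Fin n; x merely becomes isolated.
infixl 5 _-ᵛ_
_-ᵛ_ : Graph n → Fin n → Graph n
(H -ᵛ x) a b = H a b ∧ (not ⌊ a FP.≟ x ⌋ ∧ not ⌊ b FP.≟ x ⌋)

module Walks {n : ℕ} (H : Graph n) where

  adj-ᵛ⁻ : ∀ {x a b} → Adj (H -ᵛ x) a b → Adj H a b × a ≢ x × b ≢ x
  adj-ᵛ⁻ {x} {a} {b} t with to (T-∧ {H a b}) t
  ... | h , r with to (T-∧ {not ⌊ a FP.≟ x ⌋}) r
  ... | a≢x , b≢x = h , toWitnessFalse a≢x , toWitnessFalse b≢x

  adj-ᵛ⁺ : ∀ {x a b} → Adj H a b → a ≢ x → b ≢ x → Adj (H -ᵛ x) a b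
  adj-ᵛ⁺ {x} {a} {b} h a≢x b≢x = from (T-∧ {H a b})
    (h , from (T-∧ {not ⌊ a FP.≟ x ⌋}) (fromWitnessFalse a≢x , fromWitnessFalse b≢x))

  _++ʷ_ : ∀ {u v w a b} → Walk H u v a → Walk H v w b → Walk H u w (a + b)
  here ++ʷ q = q
  step e p ++ʷ q = step e (p ++ʷ q)

  _∷ʳʷ_ : ∀ {u v w a} → Walk H u v a → Adj H v w → Walk H u w (suc a)
  here ∷ʳʷ e = step e here
  step e′ p ∷ʳʷ e = step e′ (p ∷ʳʷ e)

  reverse : (∀ a b → Adj H a b → Adj H b a) → ∀ {u v k} → Walk H u v k → Walk H v u k
  reverse sym-H here = here
  reverse sym-H (step e p) = reverse sym-H p ∷ʳʷ sym-H _ _ e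

  mapʷ : ∀ {H′ : Graph n} → (∀ {a b} → Adj H a b → Adj H′ a b) → ∀ {u v k} → Walk H u v k → Walk H′ u v k
  mapʷ f here = here
  mapʷ f (step e p) = step (f e) (mapʷ f p)

  _∈ʷ_ : ∀ {u v k} → Fin n → Walk H u v k → Set
  _∈ʷ_ {u = u} x here = x ≡ u
  _∈ʷ_ {u = u} x (step e p) = x ≡ u ⊎ x ∈ʷ p

  _∈ʷ?_ : ∀ {u v k} (x : Fin n) (p : Walk H u v k) → Dec (x ∈ʷ p)
  _∈ʷ?_ {u = u} x here = x FP.≟ u
  _∈ʷ?_ {u = u} x (step e p) = (x FP.≟ u) ⊎-dec (x ∈ʷ? p)

  start∈ʷ : ∀ {u v k} (p : Walk H u v k) → u ∈ʷ p
  start∈ʷ here = refl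
  start∈ʷ (step e p) = inj₁ refl

  splitAt : ∀ {u v k x} (p : Walk H u v k) → x ∈ʷ p → ∃₂ λ i j → (i + j ≡ k) × Walk H u x i × Walk H x v j
  splitAt here refl = 0 , 0 , refl , here , here
  splitAt {k = k} (step e p) (inj₁ refl) = 0 , k , refl , here , step e p
  splitAt (step e p) (inj₂ x∈p) with splitAt p x∈p
  ... | i , j , i+j≡k , p₁ , p₂ = suc i , j , cong suc i+j≡k , step e p₁ , p₂

  avoid : ∀ {x u v k} (p : Walk H u v k) → ¬ (x ∈ʷ p) → Walk (H -ᵛ x) u v k
  avoid here x∉p = here
  avoid (step e p) x∉p =
    step (adj-ᵛ⁺ e (λ u≡x → x∉p (inj₁ (sym u≡x))) (λ w≡x → x∉p (inj₂ (subst (_∈ʷ p) w≡x (start∈ʷ p)))))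
         (avoid p (x∉p ∘ inj₂))

  lastVisit : ∀ {w v k x} (p : Walk H w v k) → x ∈ʷ p → x ≢ v →
              ∃ λ x′ → Adj H x x′ × ∃ λ j → Walk (H -ᵛ x) x′ v j
  lastVisit here refl x≢v = ⊥-elim (x≢v refl)
  lastVisit {x = x} (step e p) x∈ x≢v with x ∈ʷ? p
  ... | yes x∈p = lastVisit p x∈p x≢v
  lastVisit (step e p) (inj₁ refl) x≢v | no x∉p = _ , e , _ , avoid p x∉p
  lastVisit (step e p) (inj₂ x∈p) x≢v | no x∉p = ⊥-elim (x∉p x∈p)

  vertexAt : ∀ {u v k} → Walk H u v k → Fin (suc k) → Fin n
  vertexAt {u = u} p zero = u
  vertexAt (step e p) (suc i) = vertexAt p i

  vertexAt-last : ∀ {u v k} (p : Walk H u v k) → vertexAt p (fromℕ k) ≡ v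
  vertexAt-last here = refl
  vertexAt-last (step e p) = vertexAt-last p

  vertexAt-adj : ∀ {u v k} (p : Walk H u v k) (i : Fin k) → Adj H (vertexAt p (inject₁ i)) (vertexAt p (suc i))
  vertexAt-adj (step e here) zero = e
  vertexAt-adj (step e (step e′ p)) zero = e
  vertexAt-adj (step e p) (suc i) = vertexAt-adj p i

  suffixFrom : ∀ {u v k} (p : Walk H u v k) (j : Fin (suc k)) → ∃ λ m → toℕ j + m ≡ k × Walk H (vertexAt p j) v m
  suffixFrom {k = k} p zero = k , refl , p
  suffixFrom (step e p) (suc j) with suffixFrom p j
  ... | m , j+m≡k , q = m , cong suc j+m≡k , q

  repeat⇒shorter : ∀ {u v k} (p : Walk H u v k) (i j : Fin (suc k)) → toℕ i < toℕ j →
                   vertexAt p i ≡ vertexAt p j → ∃ λ m → m < k × Walk H u v m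
  repeat⇒shorter p zero (suc j) _ p₀≡pⱼ with suffixFrom p (suc j)
  ... | m , j+m≡k , q = m , subst (m <_) j+m≡k (s≤s (ℕP.m≤n+m m (toℕ j))) , subst (λ z → Walk H z _ m) (sym p₀≡pⱼ) q
  repeat⇒shorter (step e p) (suc i) (suc j) (s≤s i<j) pᵢ≡pⱼ with repeat⇒shorter p i j i<j pᵢ≡pⱼ
  ... | m , m<k , q = suc m , s≤s m<k , step e q

  Walk? : ∀ u v k → Dec (Walk H u v k)
  Walk? u v zero with u FP.≟ v
  ... | yes refl = yes here
  ... | no u≢v = no λ { here → u≢v refl }
  Walk? u v (suc k) with any? (λ w → T? (H u w) ×-dec Walk? w v k)
  ... | yes (w , e , p) = yes (step e p)
  ... | no ¬p = no λ { (step e p) → ¬p (_ , e , p) }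

  Walk⇒Dist : ∀ {u v k} → Walk H u v k → ∃ λ m → Dist H u v m
  Walk⇒Dist {u} {v} {k} p = search k 0 (ℕP.+-identityʳ k) (λ _ ())
    where
    search : ∀ f m → f + m ≡ k → (∀ m′ → m′ < m → ¬ Walk H u v m′) → ∃ λ m → Dist H u v m
    search f m f+m≡k shorter with Walk? u v m
    ... | yes q = m , q , λ m′ q′ → ℕP.≮⇒≥ (λ m′<m → shorter m′ m′<m q′)
    search zero m f+m≡k shorter | no ¬q = ⊥-elim (¬q (subst (Walk H u v) (sym f+m≡k) p))
    search (suc f) m f+m≡k shorter | no ¬q = search f (suc m) (trans (+-suc f m) f+m≡k) shorter′
      where
      shorter′ : ∀ m′ → m′ < suc m → ¬ Walk H u v m′
      shorter′ m′ (s≤s m′≤m) with ℕP.m≤n⇒m<n∨m≡n m′≤m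
      ... | inj₁ m′<m = shorter m′ m′<m
      ... | inj₂ refl = ¬q

  Dist⇒vertexAt-injective : ∀ {u v m} → (d : Dist H u v m) → Injective _≡_ _≡_ (vertexAt (proj₁ d))
  Dist⇒vertexAt-injective (p , minimal) {i} {j} pᵢ≡pⱼ with ℕP.<-cmp (toℕ i) (toℕ j)
  ... | tri< i<j _ _ = let (m , m<k , q) = repeat⇒shorter p i j i<j pᵢ≡pⱼ in ⊥-elim (ℕP.<⇒≱ m<k (minimal m q))
  ... | tri≈ _ i≡j _ = toℕ-injective i≡j
  ... | tri> _ _ j<i = let (m , m<k , q) = repeat⇒shorter p j i j<i (sym pᵢ≡pⱼ) in ⊥-elim (ℕP.<⇒≱ m<k (minimal m q))

  Dist⇒<n : ∀ {u v m} → Dist H u v m → m < n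
  Dist⇒<n d = injective⇒≤ (Dist⇒vertexAt-injective d)

  splitWalk : ∀ {u w} i j → Walk H u w (i + j) → ∃ λ x → Walk H u x i × Walk H x w j
  splitWalk zero j p = _ , here , p
  splitWalk (suc i) j (step e p) with splitWalk i j p
  ... | x , p₁ , p₂ = x , step e p₁ , p₂

  unsnoc : ∀ {u w j} → Walk H u w (suc j) → ∃ λ x → Walk H u x j × Adj H x w
  unsnoc (step e here) = _ , here , e
  unsnoc (step e (step e′ p)) with unsnoc (step e′ p)
  ... | x , q , x~w = x , step e q , x~w
module Tree {n : ℕ} (G : Graph n)
  (adj-sym : ∀ u v → Adj G u v → Adj G v u) (adj-irrefl : ∀ u → ¬ Adj G u u)
  (connected : Connected G) (acyclic : ¬ HasCycle G) where

  open Walks G public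

  _~_ : Fin n → Fin n → Set
  a ~ b = Adj G a b

  _~?_ : ∀ a b → Dec (a ~ b)
  a ~? b = T? (G a b)

  ~⇒≢ : ∀ {a b} → a ~ b → a ≢ b
  ~⇒≢ {a} a~b refl = adj-irrefl a a~b

  adj-ᵛ-sym : ∀ x a b → Adj (G -ᵛ x) a b → Adj (G -ᵛ x) b a
  adj-ᵛ-sym x a b e = let (a~b , a≢x , b≢x) = adj-ᵛ⁻ e in adj-ᵛ⁺ (adj-sym a b a~b) b≢x a≢x

  walk-ᵛ-end≢ : ∀ {x u v k} → Walk (G -ᵛ x) u v k → u ≢ x → v ≢ x
  walk-ᵛ-end≢ here u≢x = u≢x
  walk-ᵛ-end≢ (step e p) _ = walk-ᵛ-end≢ p (proj₂ (proj₂ (adj-ᵛ⁻ e)))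

  walk-ᵛ-forget : ∀ {x y u v k} → Walk (G -ᵛ x -ᵛ y) u v k → Walk (G -ᵛ y) u v k
  walk-ᵛ-forget {x} = Walks.mapʷ (G -ᵛ x -ᵛ _) λ e →
    let (e′ , a≢y , b≢y) = Walks.adj-ᵛ⁻ (G -ᵛ x) e in adj-ᵛ⁺ (proj₁ (adj-ᵛ⁻ e′)) a≢y b≢y

  opaque
    dist : Fin n → Fin n → ℕ
    dist u v = proj₁ (Walk⇒Dist (proj₂ (connected u v)))

    dist-walk : ∀ u v → Walk G u v (dist u v)
    dist-walk u v = proj₁ (proj₂ (Walk⇒Dist (proj₂ (connected u v))))

    dist-minimal : ∀ {u v m} → Walk G u v m → dist u v ≤ m
    dist-minimal {u} {v} {m} p = proj₂ (proj₂ (Walk⇒Dist (proj₂ (connected u v)))) m p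

  Dist⇒≡dist : ∀ {u v a} → Dist G u v a → a ≡ dist u v
  Dist⇒≡dist {u} {v} (p , minimal) = ≤-antisym (minimal _ (dist-walk u v)) (dist-minimal p)

  dist-Dist : ∀ u v → Dist G u v (dist u v)
  dist-Dist u v = dist-walk u v , λ _ → dist-minimal

  dist-triangle : ∀ u v w → dist u w ≤ dist u v + dist v w
  dist-triangle u v w = dist-minimal (dist-walk u v ++ʷ dist-walk v w)

  dist-sym : ∀ u v → dist u v ≡ dist v u
  dist-sym u v = ≤-antisym (dist-minimal (reverse adj-sym (dist-walk v u))) (dist-minimal (reverse adj-sym (dist-walk u v)))

  dist≡0⇒≡ : ∀ {u v} → dist u v ≡ 0 → u ≡ v
  dist≡0⇒≡ {u} {v} d≡0 with dist-walk u v
  ... | p rewrite d≡0 with p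
  ... | here = refl

  ~⇒dist≡1 : ∀ {u v} → u ~ v → dist u v ≡ 1
  ~⇒dist≡1 {u} {v} u~v with dist u v in d≡
  ... | zero = ⊥-elim (~⇒≢ u~v (dist≡0⇒≡ d≡))
  ... | suc zero = refl
  ... | suc (suc k) = ⊥-elim (ℕP.<⇒≱ (s≤s (s≤s z≤n)) (subst (_≤ 1) d≡ (dist-minimal (step u~v here))))

  Branch : Fin n → Fin n → Fin n → Set
  Branch x y z = y ≢ x × ∃ λ k → Walk (G -ᵛ x) y z k

  opaque
    Branch? : ∀ x y z → Dec (Branch x y z)
    Branch? x y z = map′ fromShort toShort (¬? (y FP.≟ x) ×-dec any? (λ (i : Fin n) → Walks.Walk? (G -ᵛ x) y z (toℕ i)))
      where
      fromShort : (y ≢ x × ∃ λ (i : Fin n) → Walk (G -ᵛ x) y z (toℕ i)) → Branch x y z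
      fromShort (y≢x , i , p) = y≢x , toℕ i , p
      toShort : Branch x y z → (y ≢ x × ∃ λ (i : Fin n) → Walk (G -ᵛ x) y z (toℕ i))
      toShort (y≢x , k , p) with Walks.Walk⇒Dist (G -ᵛ x) p
      ... | m , d = y≢x , fromℕ< (Walks.Dist⇒<n (G -ᵛ x) d) , subst (Walk (G -ᵛ x) y z) (sym (toℕ-fromℕ< _)) (proj₁ d)

    branch : Fin n → Fin n → Subset n
    branch x y = ⟦ Branch? x y ⟧

    ∈branch⁺ : ∀ {x y z} → Branch x y z → z ∈ branch x y
    ∈branch⁺ {x} {y} = ∈⟦⟧⁺ (Branch? x y)

    ∈branch⁻ : ∀ {x y z} → z ∈ branch x y → Branch x y z
    ∈branch⁻ {x} {y} = ∈⟦⟧⁻ (Branch? x y)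

  Branch-≢root : ∀ {x y z} → Branch x y z → z ≢ x
  Branch-≢root (y≢x , _ , p) = walk-ᵛ-end≢ p y≢x

  Branch-head : ∀ {x y} → x ~ y → Branch x y y
  Branch-head x~y = ≢-sym (~⇒≢ x~y) , 0 , here

  Branch-step : ∀ {x y z z′} → Branch x y z → z ~ z′ → z′ ≢ x → Branch x y z′
  Branch-step z∈@(y≢x , k , p) z~z′ z′≢x = y≢x , suc k , Walks._∷ʳʷ_ (G -ᵛ _) p (adj-ᵛ⁺ z~z′ (Branch-≢root z∈) z′≢x)

  Branch-walk : ∀ {x y z t k} → Branch x y z → Walk (G -ᵛ x) z t k → Branch x y t
  Branch-walk (y≢x , _ , p) q = y≢x , _ , Walks._++ʷ_ (G -ᵛ _) p q

  vertexAt-ᵛ≢ : ∀ {x u v k} (q : Walk (G -ᵛ x) u v k) → u ≢ x → ∀ i → Walks.vertexAt (G -ᵛ x) q i ≢ x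
  vertexAt-ᵛ≢ q u≢x zero = u≢x
  vertexAt-ᵛ≢ (step e q) _ (suc i) = vertexAt-ᵛ≢ q (proj₂ (proj₂ (adj-ᵛ⁻ e))) i

  -- A shortest walk from a to b avoiding y, closed up through y, is a cycle.
  Branch-separates : ∀ {y a b} → y ~ a → y ~ b → a ≢ b → ¬ Branch y a b
  Branch-separates {y} {a} {b} y~a y~b a≢b (a≢y , _ , p) with Walks.Walk⇒Dist (G -ᵛ y) p
  ... | zero , (here , _) = a≢b refl
  ... | suc m , d@(q , _) = acyclic (m , cycle , injective , consecutive , closing)
    where
    cycle : Fin (suc (suc (suc m))) → Fin n
    cycle zero = y
    cycle (suc i) = Walks.vertexAt (G -ᵛ y) q i
    injective : Injective _≡_ _≡_ cycle
    injective {zero} {zero} _ = refl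
    injective {zero} {suc j} y≡ = ⊥-elim (vertexAt-ᵛ≢ q a≢y j (sym y≡))
    injective {suc i} {zero} ≡y = ⊥-elim (vertexAt-ᵛ≢ q a≢y i ≡y)
    injective {suc i} {suc j} cᵢ≡cⱼ = cong suc (Walks.Dist⇒vertexAt-injective (G -ᵛ y) d cᵢ≡cⱼ)
    consecutive : ∀ (i : Fin (suc (suc m))) → cycle (inject₁ i) ~ cycle (suc i)
    consecutive zero = y~a
    consecutive (suc i) = proj₁ (adj-ᵛ⁻ (Walks.vertexAt-adj (G -ᵛ y) q i))
    closing : cycle (fromℕ (suc (suc m))) ~ cycle zero
    closing = subst (_~ y) (sym (Walks.vertexAt-last (G -ᵛ y) q)) (adj-sym y b y~b)

  Branch-disjoint : ∀ {m a b z} → m ~ a → m ~ b → a ≢ b → Branch m a z → Branch m b z → ⊥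
  Branch-disjoint {m} m~a m~b a≢b (a≢m , _ , p) (_ , _ , q) =
    Branch-separates m~a m~b a≢b (a≢m , _ , Walks._++ʷ_ (G -ᵛ m) p (Walks.reverse (G -ᵛ m) (adj-ᵛ-sym m) q))

  Branch-descend : ∀ {x y z} → Branch x y z → z ≢ y → ∃ λ y′ → y ~ y′ × y′ ≢ x × Branch y y′ z
  Branch-descend {x} {y} (_ , _ , p) z≢y with Walks.lastVisit (G -ᵛ x) p (Walks.start∈ʷ (G -ᵛ x) p) (≢-sym z≢y)
  ... | y′ , e , j , q =
    let (y~y′ , _ , y′≢x) = adj-ᵛ⁻ e in y′ , y~y′ , y′≢x , ≢-sym (~⇒≢ y~y′) , j , walk-ᵛ-forget q

  Branch-cover : ∀ {m z} → z ≢ m → ∃ λ c → m ~ c × Branch m c z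
  Branch-cover {m} {z} z≢m with connected m z
  ... | _ , p with lastVisit p (start∈ʷ p) (≢-sym z≢m)
  ... | c , m~c , j , q = c , m~c , ≢-sym (~⇒≢ m~c) , j , q

  Branch-nested : ∀ {x y y′ t} → x ~ y → y ~ y′ → y′ ≢ x → Branch y y′ t → Branch x y t
  Branch-nested {x} {y} x~y y~y′ y′≢x (y′≢y , k , p) with Walks._∈ʷ?_ (G -ᵛ y) x p
  ... | yes x∈p = let (i , _ , _ , p₁ , _) = Walks.splitAt (G -ᵛ y) p x∈p in
                  ⊥-elim (Branch-separates y~y′ (adj-sym x y x~y) y′≢x (y′≢y , i , p₁))
  ... | no x∉p = ≢-sym (~⇒≢ x~y) , suc k ,
                 step (adj-ᵛ⁺ y~y′ (≢-sym (~⇒≢ x~y)) y′≢x) (walk-ᵛ-forget (Walks.avoid (G -ᵛ y) p x∉p))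

  Branch-opposite-disjoint : ∀ {x y z} → x ~ y → Branch x y z → Branch y x z → ⊥
  Branch-opposite-disjoint x~y z∈xy z∈yx with Branch-descend z∈yx (Branch-≢root z∈xy)
  ... | c , x~c , c≢y , z∈xc = Branch-disjoint x~y x~c (≢-sym c≢y) z∈xy z∈xc

  Branch-opposite-cover : ∀ {x y} → x ~ y → ∀ z → Branch x y z ⊎ Branch y x z
  Branch-opposite-cover {x} {y} x~y z with z FP.≟ x
  ... | yes refl = inj₂ (Branch-head (adj-sym x y x~y))
  ... | no z≢x with Branch-cover z≢x
  ... | c , x~c , z∈ with c FP.≟ y
  ... | yes refl = inj₁ z∈
  ... | no c≢y = inj₂ (Branch-nested (adj-sym x y x~y) x~c c≢y z∈)

  dist-via-root : ∀ {x y a h} → Branch x y a → ¬ Branch x y h → dist a h ≡ dist a x + dist x h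
  dist-via-root {x} {y} {a} {h} a∈ h∉ with x ∈ʷ? dist-walk a h
  ... | no x∉p = ⊥-elim (h∉ (Branch-walk a∈ (avoid (dist-walk a h) x∉p)))
  ... | yes x∈p = let (i , j , i+j≡ , p₁ , p₂) = splitAt (dist-walk a h) x∈p in
    ≤-antisym (dist-triangle a x h) (subst (dist a x + dist x h ≤_) i+j≡ (+-mono-≤ (dist-minimal p₁) (dist-minimal p₂)))

  dist-into-branch : ∀ {x y z} → x ~ y → Branch x y z → dist x z ≡ suc (dist y z)
  dist-into-branch {x} {y} {z} x~y z∈ = begin
    dist x z              ≡⟨ dist-via-root (Branch-head (adj-sym x y x~y)) (Branch-opposite-disjoint x~y z∈) ⟩
    dist x y + dist y z   ≡⟨ cong (_+ dist y z) (~⇒dist≡1 x~y) ⟩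
    suc (dist y z)        ∎
    where open ≡-Reasoning

  neighbours : Fin n → Subset n
  neighbours z = tabulate (G z)

  3≤deg⇒threeNeighbours : ∀ z → 3 ≤ deg G z → ThreeDistinct (z ~_)
  3≤deg⇒threeNeighbours z 3≤deg with 3≤∣p∣⇒threeDistinct (neighbours z) 3≤deg
  ... | a , b , c , a∈ , b∈ , c∈ , distinct =
    a , b , c , to (∈-tabulate⇔ (G z)) a∈ , to (∈-tabulate⇔ (G z)) b∈ , to (∈-tabulate⇔ (G z)) c∈ , distinct

  threeNeighbours⇒3≤deg : ∀ z → ThreeDistinct (z ~_) → 3 ≤ deg G z
  threeNeighbours⇒3≤deg z (a , b , c , z~a , z~b , z~c , distinct) = threeDistinct⇒3≤∣p∣ (neighbours z)
    (a , b , c , from (∈-tabulate⇔ (G z)) z~a , from (∈-tabulate⇔ (G z)) z~b , from (∈-tabulate⇔ (G z)) z~c , distinct)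

  LowDegreeBranch : Fin n → Fin n → Set
  LowDegreeBranch v y = ∀ z → Branch v y z → ¬ 3 ≤ deg G z

  Misses : Subset n → Fin n → Fin n → Set
  Misses S x y = ∀ z → Branch x y z → z ∉ S

  IsLeaf : Fin n → Fin n → Set
  IsLeaf z₀ z₁ = z₀ ~ z₁ × (∀ c → z₀ ~ c → c ≡ z₁)

  _◃_ : ∀ {k} → Fin n → (Fin (suc k) → Fin n) → Fin (suc (suc k)) → Fin n
  (y ◃ p) zero = y
  (y ◃ p) (suc i) = p i

  PathEnum-prepend : ∀ {L L′ : Subset n} {k} {p : Fin (suc k) → Fin n} (y : Fin n) →
    PathEnum G L k p → (∀ i → y ≢ p i) → (∀ i → (y ~ p i) ⇔ (i ≡ zero)) →
    (∀ z → z ∈ L′ ⇔ (z ≡ y ⊎ z ∈ L)) → PathEnum G L′ (suc k) (y ◃ p)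
  PathEnum-prepend {L} {L′} {k} {p} y (inj , mem , adj) y≢p y~p mem′ = inj′ , enumerates , adj′
    where
    inj′ : Injective _≡_ _≡_ (y ◃ p)
    inj′ {zero} {zero} _ = refl
    inj′ {zero} {suc j} y≡ = ⊥-elim (y≢p j y≡)
    inj′ {suc i} {zero} ≡y = ⊥-elim (y≢p i (sym ≡y))
    inj′ {suc i} {suc j} pᵢ≡pⱼ = cong suc (inj pᵢ≡pⱼ)
    enumerates : ∀ z → z ∈ L′ ⇔ (∃ λ i → (y ◃ p) i ≡ z)
    enumerates z = mk⇔ index
      λ { (zero , refl) → from (mem′ z) (inj₁ refl) ; (suc i , pᵢ≡z) → from (mem′ z) (inj₂ (from (mem z) (i , pᵢ≡z))) }
      where
      index : z ∈ L′ → ∃ λ i → (y ◃ p) i ≡ z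
      index z∈ with to (mem′ z) z∈
      ... | inj₁ z≡y = zero , sym z≡y
      ... | inj₂ z∈L = let (i , pᵢ≡z) = to (mem z) z∈L in suc i , pᵢ≡z
    adj′ : ∀ i j → ((y ◃ p) i ~ (y ◃ p) j) ⇔ (suc (toℕ i) ≡ toℕ j ⊎ suc (toℕ j) ≡ toℕ i)
    adj′ zero zero = mk⇔ (⊥-elim ∘ adj-irrefl y) (λ { (inj₁ ()) ; (inj₂ ()) })
    adj′ zero (suc j) = mk⇔ (λ y~ → inj₁ (cong (suc ∘ toℕ) (sym (to (y~p j) y~))))
                            (λ { (inj₁ i≡) → from (y~p j) (toℕ-injective (sym (ℕP.suc-injective i≡))) ; (inj₂ ()) })
    adj′ (suc i) zero = mk⇔ (λ ~y → inj₂ (cong (suc ∘ toℕ) (sym (to (y~p i) (adj-sym _ _ ~y)))))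
                            (λ { (inj₁ ()) ; (inj₂ j≡) → adj-sym _ _ (from (y~p i) (toℕ-injective (sym (ℕP.suc-injective j≡)))) })
    adj′ (suc i) (suc j) = mk⇔ (Data.Sum.map (cong suc) (cong suc) ∘ to (adj i j))
                                (from (adj i j) ∘ Data.Sum.map ℕP.suc-injective ℕP.suc-injective)

  Branch-root-neighbour : ∀ {x y z} → x ~ y → Branch x y z → x ~ z → z ≡ y
  Branch-root-neighbour {x} {y} {z} x~y z∈ x~z with z FP.≟ y
  ... | yes z≡y = z≡y
  ... | no z≢y = ⊥-elim (Branch-separates x~y x~z (≢-sym z≢y) z∈)

  PathFrom : Fin n → Subset n → Set
  PathFrom y L = ∃ λ k → Σ (Fin (suc k) → Fin n) λ p → PathEnum G L k p × p zero ≡ y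

  PathFrom-extend : ∀ {x y} {L : Subset n} → x ~ y → PathFrom y (branch x y) →
    (∀ z → z ∈ L ⇔ (z ≡ x ⊎ z ∈ branch x y)) → PathFrom x L
  PathFrom-extend {x} {y} x~y (k , p , pe@(inj , mem , _) , p₀≡y) L≡x∪branch =
    suc k , x ◃ p , PathEnum-prepend x pe x≢p x~p L≡x∪branch , refl
    where
    p∈branch : ∀ i → Branch x y (p i)
    p∈branch i = ∈branch⁻ (from (mem (p i)) (i , refl))
    x≢p : ∀ i → x ≢ p i
    x≢p i x≡pᵢ = Branch-≢root (p∈branch i) (sym x≡pᵢ)
    x~p : ∀ i → (x ~ p i) ⇔ (i ≡ zero)
    x~p i = mk⇔ (λ x~pᵢ → inj (trans (Branch-root-neighbour x~y (p∈branch i) x~pᵢ) (sym p₀≡y)))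
                (λ { refl → subst (x ~_) (sym p₀≡y) x~y })

  pathBranch⇒Leg : ∀ {x y} → x ~ y → PathFrom y (branch x y) → Leg G x (branch x y)
  pathBranch⇒Leg {x} {y} x~y (k , p , pe , p₀≡y) =
    (λ x∈ → Branch-≢root (∈branch⁻ x∈) refl) ,
    (λ a b a∈ a~b b≢x → ∈branch⁺ (Branch-step (∈branch⁻ a∈) a~b b≢x)) ,
    k , p , pe ,
    λ z z∈ → mk⇔ (λ x~z → trans (Branch-root-neighbour x~y (∈branch⁻ z∈) x~z) (sym p₀≡y))
                 (λ z≡p₀ → subst (x ~_) (sym (trans z≡p₀ p₀≡y)) x~y)

  NoLegFork : Fin n → Fin n → Set
  NoLegFork x y = ∀ w w₀ w₁ w₂ → Branch x y w → (∀ t → Branch w w₁ t → Branch x y t) → (∀ t → Branch w w₂ t → Branch x y t) →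
    Distinct₃ (w ~_) w₀ w₁ w₂ → Leg G w (branch w w₁) → Leg G w (branch w w₂) → ⊥

  ∣branch∣-nested< : ∀ {x y y₁} → x ~ y → y ~ y₁ → y₁ ≢ x → ∣ branch y y₁ ∣ < ∣ branch x y ∣
  ∣branch∣-nested< x~y y~y₁ y₁≢x =
    p⊂q⇒∣p∣<∣q∣ ((λ t∈ → ∈branch⁺ (Branch-nested x~y y~y₁ y₁≢x (∈branch⁻ t∈))) ,
                 _ , ∈branch⁺ (Branch-head x~y) , λ y∈ → Branch-≢root (∈branch⁻ y∈) refl)

  NoLegFork-nested : ∀ {x y y₁} → x ~ y → y ~ y₁ → y₁ ≢ x → NoLegFork x y → NoLegFork y y₁
  NoLegFork-nested x~y y~y₁ y₁≢x noFork w w₀ w₁ w₂ w∈ ⊆₁ ⊆₂ =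
    noFork w w₀ w₁ w₂ (nest w∈) (λ t t∈ → nest (⊆₁ t t∈)) (λ t t∈ → nest (⊆₂ t t∈))
    where
    nest : ∀ {t} → Branch _ _ t → Branch _ _ t
    nest = Branch-nested x~y y~y₁ y₁≢x

  -- Induction on the size of the branch: a second neighbour of y (besides x) would create a fork of two legs.
  branchIsPath : ∀ s x y → ∣ branch x y ∣ < s → x ~ y → NoLegFork x y → PathFrom y (branch x y)
  branchIsPath (suc s) x y ∣branch∣<1+s x~y noFork
    with any? (λ y₁ → (y ~? y₁) ×-dec ¬? (y₁ FP.≟ x))
  ... | no noNeighbour = 0 , (λ _ → y) , ((λ { {zero} {zero} _ → refl }) , singleton , λ { zero zero → noLoop }) , refl
    where
    singleton : ∀ z → z ∈ branch x y ⇔ (∃ λ (i : Fin 1) → y ≡ z)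
    singleton z = mk⇔ only (λ { (zero , refl) → ∈branch⁺ (Branch-head x~y) })
      where
      only : z ∈ branch x y → ∃ λ (i : Fin 1) → y ≡ z
      only z∈ with z FP.≟ y
      ... | yes z≡y = zero , sym z≡y
      ... | no z≢y = let (y′ , y~y′ , y′≢x , _) = Branch-descend (∈branch⁻ z∈) z≢y in ⊥-elim (noNeighbour (y′ , y~y′ , y′≢x))
    noLoop : (y ~ y) ⇔ (1 ≡ 0 ⊎ 1 ≡ 0)
    noLoop = mk⇔ (⊥-elim ∘ adj-irrefl y) (λ { (inj₁ ()) ; (inj₂ ()) })
  ... | yes (y₁ , y~y₁ , y₁≢x) with any? (λ y₂ → (y ~? y₂) ×-dec ¬? (y₂ FP.≟ x) ×-dec ¬? (y₂ FP.≟ y₁))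
  ... | yes (y₂ , y~y₂ , y₂≢x , y₂≢y₁) =
    ⊥-elim (noFork y x y₁ y₂ (Branch-head x~y) (λ t → Branch-nested x~y y~y₁ y₁≢x) (λ t → Branch-nested x~y y~y₂ y₂≢x)
               (adj-sym x y x~y , y~y₁ , y~y₂ , ≢-sym y₁≢x , ≢-sym y₂≢x , ≢-sym y₂≢y₁)
               (pathBranch⇒Leg y~y₁ (recurse y₁ y~y₁ y₁≢x)) (pathBranch⇒Leg y~y₂ (recurse y₂ y~y₂ y₂≢x)))
    where
    recurse : ∀ y′ → y ~ y′ → y′ ≢ x → PathFrom y′ (branch y y′)
    recurse y′ y~y′ y′≢x = branchIsPath s y y′ (≤-trans (∣branch∣-nested< x~y y~y′ y′≢x) (ℕP.≤-pred ∣branch∣<1+s))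
                             y~y′ (NoLegFork-nested x~y y~y′ y′≢x noFork)
  ... | no onlyY₁ = PathFrom-extend y~y₁
          (branchIsPath s y y₁ (≤-trans (∣branch∣-nested< x~y y~y₁ y₁≢x) (ℕP.≤-pred ∣branch∣<1+s))
             y~y₁ (NoLegFork-nested x~y y~y₁ y₁≢x noFork))
          (λ z → mk⇔ (split z) [ (λ { refl → ∈branch⁺ (Branch-head x~y) }) , (λ z∈ → ∈branch⁺ (Branch-nested x~y y~y₁ y₁≢x (∈branch⁻ z∈))) ])
    where
    split : ∀ z → z ∈ branch x y → z ≡ y ⊎ z ∈ branch y y₁
    split z z∈ with z FP.≟ y
    ... | yes z≡y = inj₁ z≡y
    ... | no z≢y with Branch-descend (∈branch⁻ z∈) z≢y
    ... | y′ , y~y′ , y′≢x , z∈′ with y′ FP.≟ y₁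
    ... | yes refl = inj₂ (∈branch⁺ z∈′)
    ... | no y′≢y₁ = ⊥-elim (onlyY₁ (y′ , y~y′ , y′≢x , y′≢y₁))

  NoLegFork⇒Leg : ∀ x y → x ~ y → NoLegFork x y → Leg G x (branch x y)
  NoLegFork⇒Leg x y x~y noFork = pathBranch⇒Leg x~y (branchIsPath (suc ∣ branch x y ∣) x y ≤-refl x~y noFork)


  module LegFacts {v : Fin n} {L : Subset n} (leg : Leg G v L) where
    private
      v∉L = proj₁ leg
      closed = proj₁ (proj₂ leg)
      k = proj₁ (proj₂ (proj₂ leg))
      pe = proj₁ (proj₂ (proj₂ (proj₂ (proj₂ leg))))
      v~⇔head = proj₂ (proj₂ (proj₂ (proj₂ (proj₂ leg))))
      inj = proj₁ pe
      mem = proj₁ (proj₂ pe)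
      adj = proj₂ (proj₂ pe)

    p : Fin (suc k) → Fin n
    p = proj₁ (proj₂ (proj₂ (proj₂ leg)))

    p∈L : ∀ i → p i ∈ L
    p∈L i = from (mem (p i)) (i , refl)

    root~head : v ~ p zero
    root~head = from (v~⇔head (p zero) (p∈L zero)) refl

    walk-ᵛ-stays : ∀ {a b j} → Walk (G -ᵛ v) a b j → a ∈ L → b ∈ L
    walk-ᵛ-stays here a∈L = a∈L
    walk-ᵛ-stays (step e q) a∈L = let (a~ , _ , ≢v) = adj-ᵛ⁻ e in walk-ᵛ-stays q (closed _ _ a∈L a~ ≢v)

    ∈L⇒≢v : ∀ {z} → z ∈ L → z ≢ v
    ∈L⇒≢v z∈L refl = v∉L z∈L

    prefix-Branch : ∀ m (m<1+k : m < suc k) → Branch v (p zero) (p (fromℕ< m<1+k))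
    prefix-Branch zero _ = ∈L⇒≢v (p∈L zero) , 0 , here
    prefix-Branch (suc m) 1+m<1+k = Branch-step (prefix-Branch m m<1+k) pₘ~pₘ₊₁ (∈L⇒≢v (p∈L _))
      where
      m<1+k : m < suc k
      m<1+k = <-trans (n<1+n m) 1+m<1+k
      pₘ~pₘ₊₁ : p (fromℕ< m<1+k) ~ p (fromℕ< 1+m<1+k)
      pₘ~pₘ₊₁ = from (adj _ _) (inj₁ (trans (cong suc (toℕ-fromℕ< m<1+k)) (sym (toℕ-fromℕ< 1+m<1+k))))

    ∈leg⇔Branch : ∀ z → z ∈ L ⇔ Branch v (p zero) z
    ∈leg⇔Branch z = mk⇔ inBranch (λ (_ , _ , q) → walk-ᵛ-stays q (p∈L zero))
      where
      inBranch : z ∈ L → Branch v (p zero) z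
      inBranch z∈L with to (mem z) z∈L
      ... | i , refl = subst (λ j → Branch v (p zero) (p j)) (fromℕ<-toℕ i (toℕ<n i)) (prefix-Branch (toℕ i) (toℕ<n i))

    leg≡branch : L ≡ branch v (p zero)
    leg≡branch = ⊆-antisym (λ {z} z∈ → ∈branch⁺ (to (∈leg⇔Branch z) z∈)) (λ {z} z∈ → from (∈leg⇔Branch z) (∈branch⁻ z∈))

    Below Above : Fin (suc k) → Fin n → Set
    Below i t = (t ≡ v × toℕ i ≡ 0) ⊎ (∃ λ j → p j ≡ t × suc (toℕ j) ≡ toℕ i)
    Above i t = ∃ λ j → p j ≡ t × suc (toℕ i) ≡ toℕ j

    neighbour-classify : ∀ i t → p i ~ t → Below i t ⊎ Above i t
    neighbour-classify i t pᵢ~t with t ∈? L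
    ... | yes t∈L with to (mem t) t∈L
    ... | j , pⱼ≡t with to (adj i j) (subst (p i ~_) (sym pⱼ≡t) pᵢ~t)
    ... | inj₁ above = inj₂ (j , pⱼ≡t , above)
    ... | inj₂ below = inj₁ (inj₂ (j , pⱼ≡t , below))
    neighbour-classify i t pᵢ~t | no t∉L with t FP.≟ v
    ... | yes refl = inj₁ (inj₁ (refl , cong toℕ (inj (to (v~⇔head (p i) (p∈L i)) (adj-sym _ _ pᵢ~t)))))
    ... | no t≢v = ⊥-elim (t∉L (closed _ _ (p∈L i) pᵢ~t t≢v))

    Below-unique : ∀ {i s t} → Below i s → Below i t → s ≡ t
    Below-unique (inj₁ (s≡v , _)) (inj₁ (t≡v , _)) = trans s≡v (sym t≡v)
    Below-unique (inj₁ (_ , i≡0)) (inj₂ (_ , _ , 1+j≡i)) = ⊥-elim (ℕP.1+n≢0 (trans 1+j≡i i≡0))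
    Below-unique (inj₂ (_ , _ , 1+j≡i)) (inj₁ (_ , i≡0)) = ⊥-elim (ℕP.1+n≢0 (trans 1+j≡i i≡0))
    Below-unique (inj₂ (j , pⱼ≡s , 1+j≡i)) (inj₂ (j′ , pⱼ′≡t , 1+j′≡i)) =
      trans (sym pⱼ≡s) (trans (cong p (toℕ-injective (ℕP.suc-injective (trans 1+j≡i (sym 1+j′≡i))))) pⱼ′≡t)

    Above-unique : ∀ {i s t} → Above i s → Above i t → s ≡ t
    Above-unique (j , pⱼ≡s , 1+i≡j) (j′ , pⱼ′≡t , 1+i≡j′) =
      trans (sym pⱼ≡s) (trans (cong p (toℕ-injective (trans (sym 1+i≡j) 1+i≡j′))) pⱼ′≡t)

    leg-deg<3 : ∀ z → z ∈ L → ¬ 3 ≤ deg G z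
    leg-deg<3 z z∈L 3≤deg with to (mem z) z∈L
    ... | i , refl with 3≤deg⇒threeNeighbours (p i) 3≤deg
    ... | a , b , c , pᵢ~a , pᵢ~b , pᵢ~c , a≢b , a≢c , b≢c =
      pigeonhole (neighbour-classify i a pᵢ~a) (neighbour-classify i b pᵢ~b) (neighbour-classify i c pᵢ~c)
      where
      pigeonhole : Below i a ⊎ Above i a → Below i b ⊎ Above i b → Below i c ⊎ Above i c → ⊥
      pigeonhole (inj₁ a↓) (inj₁ b↓) _ = a≢b (Below-unique a↓ b↓)
      pigeonhole (inj₁ a↓) (inj₂ b↑) (inj₁ c↓) = a≢c (Below-unique a↓ c↓)
      pigeonhole (inj₁ a↓) (inj₂ b↑) (inj₂ c↑) = b≢c (Above-unique b↑ c↑)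
      pigeonhole (inj₂ a↑) (inj₂ b↑) _ = a≢b (Above-unique a↑ b↑)
      pigeonhole (inj₂ a↑) (inj₁ b↓) (inj₂ c↑) = a≢c (Above-unique a↑ c↑)
      pigeonhole (inj₂ a↑) (inj₁ b↓) (inj₁ c↓) = b≢c (Below-unique b↓ c↓)

    leaf : ∃₂ IsLeaf
    leaf = lastVertex k refl
      where
      lastVertex : ∀ j → j ≡ k → ∃₂ IsLeaf
      lastVertex zero refl = p zero , v , adj-sym _ _ root~head , onlyV
        where
        onlyV : ∀ c → p zero ~ c → c ≡ v
        onlyV c p₀~c with neighbour-classify zero c p₀~c
        ... | inj₁ (inj₁ (c≡v , _)) = c≡v
        ... | inj₁ (inj₂ (zero , _ , ()))
        ... | inj₂ (zero , _ , ())
      lastVertex (suc j) refl = p (fromℕ (suc j)) , p (inject₁ (fromℕ j)) , adj-sym _ _ (from (adj _ _) (inj₁ consecutive)) , onlyPrev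
        where
        toℕ-last : toℕ (inject₁ (fromℕ j)) ≡ j
        toℕ-last = trans (toℕ-inject₁ (fromℕ j)) (toℕ-fromℕ j)
        consecutive : suc (toℕ (inject₁ (fromℕ j))) ≡ toℕ (fromℕ (suc j))
        consecutive = trans (cong suc toℕ-last) (sym (toℕ-fromℕ (suc j)))
        onlyPrev : ∀ c → p (fromℕ (suc j)) ~ c → c ≡ p (inject₁ (fromℕ j))
        onlyPrev c pₖ~c with neighbour-classify (fromℕ (suc j)) c pₖ~c
        ... | inj₁ (inj₁ (_ , k≡0)) = ⊥-elim (ℕP.1+n≢0 (trans (sym (toℕ-fromℕ (suc j))) k≡0))
        ... | inj₁ (inj₂ (i , pᵢ≡c , 1+i≡k)) =
          trans (sym pᵢ≡c) (cong p (toℕ-injective (trans (ℕP.suc-injective (trans 1+i≡k (toℕ-fromℕ (suc j)))) (sym toℕ-last))))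
        ... | inj₂ (i , _ , 1+k≡i) = ⊥-elim (ℕP.<⇒≱ (toℕ<n i) (ℕP.≤-reflexive (trans (cong suc (sym (toℕ-fromℕ (suc j)))) 1+k≡i)))

  -- Equivalent to Leg G v (branch v y) (LegHead⇒Leg, Leg⇒LegHead), but decidable.
  LegHead : Fin n → Fin n → Set
  LegHead v y = v ~ y × LowDegreeBranch v y

  opaque
    LegHead? : ∀ v y → Dec (LegHead v y)
    LegHead? v y = (v ~? y) ×-dec all? (λ z → Branch? v y z →-dec ¬? (3 ≤? deg G z))

  LowDegree⇒NoLegFork : ∀ x y → LowDegreeBranch x y → NoLegFork x y
  LowDegree⇒NoLegFork x y lowDegree w w₀ w₁ w₂ w∈ _ _ distinct _ _ = lowDegree w w∈ (threeNeighbours⇒3≤deg w (w₀ , w₁ , w₂ , distinct))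

  LegHead⇒Leg : ∀ {v y} → LegHead v y → Leg G v (branch v y)
  LegHead⇒Leg {v} {y} (v~y , lowDegree) = NoLegFork⇒Leg v y v~y (LowDegree⇒NoLegFork v y lowDegree)

  Leg⇒LowDegreeBranch : ∀ {v y} → Leg G v (branch v y) → LowDegreeBranch v y
  Leg⇒LowDegreeBranch leg z z∈ = LegFacts.leg-deg<3 leg z (∈branch⁺ z∈)

  Leg⇒LegHead : ∀ {v L} (leg : Leg G v L) → LegHead v (LegFacts.p leg zero) × L ≡ branch v (LegFacts.p leg zero)
  Leg⇒LegHead leg =
    (LegFacts.root~head leg , λ z z∈ → LegFacts.leg-deg<3 leg z (from (LegFacts.∈leg⇔Branch leg z) z∈)) ,
    LegFacts.leg≡branch leg

  ExteriorMajor′ : Fin n → Set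
  ExteriorMajor′ v = 3 ≤ deg G v × ∃ (LegHead v)

  ExteriorMajor⇒′ : ∀ {v} → ExteriorMajor G v → ExteriorMajor′ v
  ExteriorMajor⇒′ (3≤deg , _ , leg) = 3≤deg , _ , proj₁ (Leg⇒LegHead leg)

  ′⇒ExteriorMajor : ∀ {v} → ExteriorMajor′ v → ExteriorMajor G v
  ′⇒ExteriorMajor (3≤deg , _ , head) = 3≤deg , _ , LegHead⇒Leg head

  opaque
    ExteriorMajor′? : ∀ v → Dec (ExteriorMajor′ v)
    ExteriorMajor′? v = (3 ≤? deg G v) ×-dec any? (LegHead? v)

  lowDegree∧leaf⇒path : (∀ z → ¬ 3 ≤ deg G z) → ∃₂ IsLeaf → IsPathGraph G
  lowDegree∧leaf⇒path lowDegree (z₀ , z₁ , z₀~z₁ , onlyZ₁)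
    with PathFrom-extend z₀~z₁ (branchIsPath (suc ∣ branch z₀ z₁ ∣) z₀ z₁ ≤-refl z₀~z₁ noFork) everything
    where
    noFork : NoLegFork z₀ z₁
    noFork = LowDegree⇒NoLegFork z₀ z₁ (λ z _ → lowDegree z)
    everything : ∀ z → z ∈ ⊤ ⇔ (z ≡ z₀ ⊎ z ∈ branch z₀ z₁)
    everything z = mk⇔ split (λ _ → ∈⊤)
      where
      split : z ∈ ⊤ → z ≡ z₀ ⊎ z ∈ branch z₀ z₁
      split _ with z FP.≟ z₀
      ... | yes z≡z₀ = inj₁ z≡z₀
      ... | no z≢z₀ with Branch-cover z≢z₀
      ... | c , z₀~c , z∈ = inj₂ (∈branch⁺ (subst (λ t → Branch z₀ t z) (onlyZ₁ c z₀~c) z∈))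
  ... | k , p , pe , _ = k , p , pe

  dist-out-of-branch : ∀ {x y h} → x ~ y → ¬ Branch x y h → dist y h ≡ suc (dist x h)
  dist-out-of-branch {x} {y} {h} x~y h∉ = begin
    dist y h              ≡⟨ dist-via-root (Branch-head x~y) h∉ ⟩
    dist y x + dist x h   ≡⟨ cong (_+ dist x h) (~⇒dist≡1 (adj-sym x y x~y)) ⟩
    suc (dist x h)        ∎
    where open ≡-Reasoning

  ∈ʷ⇒dist-start≤ : ∀ {s t l x} (p : Walk G s t l) → x ∈ʷ p → dist s x ≤ l
  ∈ʷ⇒dist-start≤ p x∈p with splitAt p x∈p
  ... | i , j , i+j≡l , p₁ , _ = ≤-trans (dist-minimal p₁) (subst (_ ≤_) i+j≡l (m≤m+n i j))

  ∈ʷ⇒dist-end≤ : ∀ {s t l x} (p : Walk G s t l) → x ∈ʷ p → dist x t ≤ l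
  ∈ʷ⇒dist-end≤ p x∈p with splitAt p x∈p
  ... | i , j , i+j≡l , _ , p₂ = ≤-trans (dist-minimal p₂) (subst (_ ≤_) i+j≡l (ℕP.m≤n+m j i))

  geodesic-edge : ∀ {u x y w i j} → Walk G u x i → x ~ y → Walk G y w j → dist u w ≡ i + suc j →
                  dist u x ≡ i × dist y w ≡ j × Branch y x u × Branch x y w
  geodesic-edge {u} {x} {y} {w} {i} {j} p x~y q d≡ =
    proj₁ tight , ℕP.suc-injective (proj₂ tight) , u∈ , w∈
    where
    tight : dist u x ≡ i × suc (dist y w) ≡ suc j
    tight = +-squeeze (dist-minimal p) (s≤s (dist-minimal q)) (begin
      i + suc j                  ≡⟨ d≡ ⟨
      dist u w                   ≤⟨ dist-triangle u x w ⟩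
      dist u x + dist x w        ≤⟨ +-monoʳ-≤ (dist u x) (dist-minimal (step x~y (dist-walk y w))) ⟩
      dist u x + suc (dist y w)  ∎)
      where open ℕP.≤-Reasoning
    no-shortcut : ∀ {a b} → a ≤ i → b ≤ j → ¬ (dist u w ≤ a + b)
    no-shortcut a≤i b≤j d≤ = ℕP.<⇒≱ (subst (i + j <_) (sym d≡) (+-monoʳ-< i ≤-refl)) (≤-trans d≤ (+-mono-≤ a≤i b≤j))
    u∈ : Branch y x u
    u∈ with y ∈ʷ? p
    ... | yes y∈p = ⊥-elim (no-shortcut (∈ʷ⇒dist-start≤ p y∈p) (dist-minimal q) (dist-triangle u y w))
    ... | no y∉p = ~⇒≢ x~y , i , Walks.reverse (G -ᵛ y) (adj-ᵛ-sym y) (avoid p y∉p)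
    w∈ : Branch x y w
    w∈ with x ∈ʷ? q
    ... | yes x∈q = ⊥-elim (no-shortcut (dist-minimal p) (∈ʷ⇒dist-end≤ q x∈q) (dist-triangle u x w))
    ... | no x∉q = ≢-sym (~⇒≢ x~y) , j , avoid q x∉q

  ⊆two⇒¬3≤deg : ∀ {m a b} → (∀ c → m ~ c → c ≡ a ⊎ c ≡ b) → ¬ 3 ≤ deg G m
  ⊆two⇒¬3≤deg {m} onlyAB 3≤deg with 3≤deg⇒threeNeighbours m 3≤deg
  ... | x , y , z , m~x , m~y , m~z , x≢y , x≢z , y≢z with onlyAB x m~x | onlyAB y m~y | onlyAB z m~z
  ... | inj₁ refl | inj₁ refl | _ = x≢y refl
  ... | inj₁ refl | inj₂ refl | inj₁ refl = x≢z refl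
  ... | inj₁ refl | inj₂ refl | inj₂ refl = y≢z refl
  ... | inj₂ refl | inj₂ refl | _ = x≢y refl
  ... | inj₂ refl | inj₁ refl | inj₂ refl = x≢z refl
  ... | inj₂ refl | inj₁ refl | inj₁ refl = y≢z refl

  opposite-legs⇒path : ∀ {x y} → x ~ y → Leg G x (branch x y) → Leg G y (branch y x) → IsPathGraph G
  opposite-legs⇒path x~y leg leg′ = lowDegree∧leaf⇒path lowDegree (LegFacts.leaf leg)
    where
    lowDegree : ∀ z → ¬ 3 ≤ deg G z
    lowDegree z with Branch-opposite-cover x~y z
    ... | inj₁ z∈ = LegFacts.leg-deg<3 leg z (∈branch⁺ z∈)
    ... | inj₂ z∈ = LegFacts.leg-deg<3 leg′ z (∈branch⁺ z∈)

  two-legs⇒path : ∀ {m a b} → (∀ c → m ~ c → c ≡ a ⊎ c ≡ b) → Leg G m (branch m a) → Leg G m (branch m b) → IsPathGraph G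
  two-legs⇒path {m} onlyAB legA legB = lowDegree∧leaf⇒path lowDegree (LegFacts.leaf legA)
    where
    lowDegree : ∀ z → ¬ 3 ≤ deg G z
    lowDegree z with z FP.≟ m
    ... | yes refl = ⊆two⇒¬3≤deg onlyAB
    ... | no z≢m with Branch-cover z≢m
    ... | c , m~c , z∈ with onlyAB c m~c
    ... | inj₁ refl = LegFacts.leg-deg<3 legA z (∈branch⁺ z∈)
    ... | inj₂ refl = LegFacts.leg-deg<3 legB z (∈branch⁺ z∈)

module NonPathTree {n : ℕ} (G : Graph n)
  (adj-sym : ∀ u v → Adj G u v → Adj G v u) (adj-irrefl : ∀ u → ¬ Adj G u u)
  (connected : Connected G) (acyclic : ¬ HasCycle G) (¬path : ¬ IsPathGraph G) where

  open Tree G adj-sym adj-irrefl connected acyclic public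

  LegPair : Fin n → Fin n → Fin n → Set
  LegPair v y₁ y₂ = ExteriorMajor′ v × LegHead v y₁ × LegHead v y₂ × y₁ ≢ y₂

  MeetsLegPair : Subset n → Fin n → Fin n → Fin n → Set
  MeetsLegPair S v y₁ y₂ = ∃ λ z → z ∈ S × (Branch v y₁ z ⊎ Branch v y₂ z)

  MeetsLegPairs : Subset n → Set
  MeetsLegPairs S = ∀ v y₁ y₂ → LegPair v y₁ y₂ → MeetsLegPair S v y₁ y₂

  -- The heads of two legs missed by S are both at distance dist v h + 1 from every h ∈ S.
  resolving⇒meetsLegPairs : ∀ S → Resolving G S → MeetsLegPairs S
  resolving⇒meetsLegPairs S resolving v y₁ y₂ (_ , (v~y₁ , _) , (v~y₂ , _) , y₁≢y₂)
    with any? (λ z → (z ∈? S) ×-dec (Branch? v y₁ z ⊎-dec Branch? v y₂ z))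
  ... | yes met = met
  ... | no unmet with resolving y₁ y₂ y₁≢y₂
  ... | h , h∈S , a , b , da , db , a≢b = ⊥-elim (a≢b (begin
    a               ≡⟨ Dist⇒≡dist da ⟩
    dist y₁ h       ≡⟨ dist-out-of-branch v~y₁ (λ h∈ → unmet (h , h∈S , inj₁ h∈)) ⟩
    suc (dist v h)  ≡⟨ dist-out-of-branch v~y₂ (λ h∈ → unmet (h , h∈S , inj₂ h∈)) ⟨
    dist y₂ h       ≡⟨ Dist⇒≡dist db ⟨
    b               ∎))
    where open ≡-Reasoning


  Misses⇒Leg : ∀ {S} → MeetsLegPairs S → ∀ {x y} → x ~ y → Misses S x y → Leg G x (branch x y)
  Misses⇒Leg {S} meets {x} {y} x~y free = NoLegFork⇒Leg x y x~y noFork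
    where
    noFork : NoLegFork x y
    noFork w w₀ w₁ w₂ _ ⊆₁ ⊆₂ distinct@(_ , w~w₁ , w~w₂ , _ , _ , w₁≢w₂) leg₁ leg₂
      with meets w w₁ w₂ ((threeNeighbours⇒3≤deg w (w₀ , w₁ , w₂ , distinct) , w₁ , head₁) , head₁ , head₂ , w₁≢w₂)
      where
      head₁ = w~w₁ , Leg⇒LowDegreeBranch leg₁
      head₂ = w~w₂ , Leg⇒LowDegreeBranch leg₂
    ... | z , z∈S , inj₁ z∈ = free z (⊆₁ z z∈) z∈S
    ... | z , z∈S , inj₂ z∈ = free z (⊆₂ z z∈) z∈S

  Equidistant : Subset n → Fin n → Fin n → Set
  Equidistant S u w = ∀ h → h ∈ S → dist u h ≡ dist w h

  nearer-in-branch : ∀ {m a u w s} → m ~ a → ¬ Branch m a w → dist u a ≤ dist w m → Branch m a s → dist u s < dist w s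
  nearer-in-branch {m} {a} {u} {w} {s} m~a w∉ du≤dw s∈ = begin-strict
    dist u s                   ≤⟨ dist-triangle u a s ⟩
    dist u a + dist a s        ≤⟨ +-monoˡ-≤ (dist a s) du≤dw ⟩
    dist w m + dist a s        <⟨ +-monoʳ-< (dist w m) (n<1+n (dist a s)) ⟩
    dist w m + suc (dist a s)  ≡⟨ cong₂ _+_ (dist-sym w m) (sym (dist-into-branch m~a s∈)) ⟩
    dist m w + dist m s        ≡⟨ ℕP.+-comm (dist m w) (dist m s) ⟩
    dist m s + dist m w        ≡⟨ cong (_+ dist m w) (dist-sym m s) ⟩
    dist s m + dist m w        ≡⟨ dist-via-root s∈ w∉ ⟨
    dist s w                   ≡⟨ dist-sym s w ⟩
    dist w s                   ∎
    where open ℕP.≤-Reasoning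

  equidistant⇒Misses : ∀ {S m a u w} → Equidistant S u w → m ~ a → ¬ Branch m a w → dist u a ≤ dist w m → Misses S m a
  equidistant⇒Misses equidistant m~a w∉ du≤dw s s∈ s∈S = <⇒≢ (nearer-in-branch m~a w∉ du≤dw s∈) (equidistant s s∈S)

  module _ {S} (meets : MeetsLegPairs S) where

    Misses-edge⇒⊥ : ∀ {x y} → x ~ y → Misses S x y → Misses S y x → ⊥
    Misses-edge⇒⊥ {x} {y} x~y freeXY freeYX =
      ¬path (opposite-legs⇒path x~y (Misses⇒Leg meets x~y freeXY) (Misses⇒Leg meets (adj-sym x y x~y) freeYX))

    -- A third neighbour of m makes m exterior major with two legs missed by S; without one, T is a path.
    Misses-fork⇒⊥ : ∀ {m a b} → m ~ a → m ~ b → a ≢ b → Misses S m a → Misses S m b → ⊥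
    Misses-fork⇒⊥ {m} {a} {b} m~a m~b a≢b freeA freeB = thirdNeighbour (any? (λ c → (m ~? c) ×-dec ¬? (c FP.≟ a) ×-dec ¬? (c FP.≟ b)))
      where
      legA = Misses⇒Leg meets m~a freeA
      legB = Misses⇒Leg meets m~b freeB
      headA : LegHead m a
      headA = m~a , Leg⇒LowDegreeBranch legA
      headB : LegHead m b
      headB = m~b , Leg⇒LowDegreeBranch legB
      thirdNeighbour : Dec (∃ λ c → m ~ c × c ≢ a × c ≢ b) → ⊥
      thirdNeighbour (yes (c , m~c , c≢a , c≢b))
        with meets m a b ((threeNeighbours⇒3≤deg m (a , b , c , m~a , m~b , m~c , a≢b , ≢-sym c≢a , ≢-sym c≢b) , a , headA) , headA , headB , a≢b)
      ... | z , z∈S , inj₁ z∈ = freeA z z∈ z∈S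
      ... | z , z∈S , inj₂ z∈ = freeB z z∈ z∈S
      thirdNeighbour (no noThird) = ¬path (two-legs⇒path onlyAB legA legB)
        where
        onlyAB : ∀ c → m ~ c → c ≡ a ⊎ c ≡ b
        onlyAB c m~c with c FP.≟ a | c FP.≟ b
        ... | yes c≡a | _ = inj₁ c≡a
        ... | no _ | yes c≡b = inj₂ c≡b
        ... | no c≢a | no c≢b = ⊥-elim (noThird (c , m~c , c≢a , c≢b))

  -- The middle of a geodesic between two vertices that S does not resolve is an edge or a vertex
  -- whose sides towards the two ends are missed by S.
  module _ {S} (meets : MeetsLegPairs S) {u w} (equidistant : Equidistant S u w) where

    private
      equidistant′ : Equidistant S w u
      equidistant′ h h∈S = sym (equidistant h h∈S)

    middle-edge⇒⊥ : ∀ {x y i} → Walk G u x i → x ~ y → Walk G y w i → dist u w ≡ i + suc i → ⊥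
    middle-edge⇒⊥ {x} {y} p x~y q d≡ with geodesic-edge p x~y q d≡
    ... | du≡ , dw≡ , u∈ , w∈ = Misses-edge⇒⊥ meets x~y
      (equidistant⇒Misses equidistant′ x~y (λ u∈′ → Branch-opposite-disjoint x~y u∈′ u∈)
         (subst₂ _≤_ (trans (sym dw≡) (dist-sym y w)) (sym du≡) ≤-refl))
      (equidistant⇒Misses equidistant (adj-sym x y x~y) (Branch-opposite-disjoint x~y w∈)
         (subst₂ _≤_ (sym du≡) (trans (sym dw≡) (dist-sym y w)) ≤-refl))

    middle-vertex⇒⊥ : ∀ {a m b i} → Walk G u a i → a ~ m → m ~ b → Walk G b w i → dist u w ≡ suc i + suc i → ⊥
    middle-vertex⇒⊥ {a} {m} {b} {i} p a~m m~b q d≡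
      with geodesic-edge p a~m (step m~b q) (trans d≡ (sym (+-suc i (suc i))))
         | geodesic-edge (p ∷ʳʷ a~m) m~b q d≡
    ... | dua≡ , dmw≡ , u∈ , _ | dum≡ , dbw≡ , _ , w∈ = Misses-fork⇒⊥ meets m~a m~b a≢b
      (equidistant⇒Misses equidistant m~a (λ w∈′ → Branch-disjoint m~a m~b a≢b w∈′ w∈)
         (subst₂ _≤_ (sym dua≡) (trans (sym dmw≡) (dist-sym m w)) (n≤1+n i)))
      (equidistant⇒Misses equidistant′ m~b (λ u∈′ → Branch-disjoint m~a m~b a≢b u∈ u∈′)
         (subst₂ _≤_ (trans (sym dbw≡) (dist-sym b w)) (sym dum≡) (n≤1+n i)))
      where
      m~a : m ~ a
      m~a = adj-sym a m a~m
      a≢b : a ≢ b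
      a≢b refl = ℕP.<⇒≱ (subst (i + i <_) (sym d≡) (ℕP.m<n⇒m<1+n (+-monoʳ-< i (n<1+n i))))
                   (≤-trans (dist-triangle u a w) (ℕP.≤-reflexive (cong₂ _+_ dua≡ dbw≡)))

    equidistant⇒≡ : u ≡ w
    equidistant⇒≡ with even⊎odd (dist u w)
    ... | zero , inj₁ d≡0 = dist≡0⇒≡ d≡0
    ... | suc j , inj₁ d≡ with splitWalk (suc j) (suc j) (subst (Walk G u w) d≡ (dist-walk u w))
    ... | m , p , step m~b q with unsnoc p
    ... | a , p′ , a~m = ⊥-elim (middle-vertex⇒⊥ p′ a~m m~b q d≡)
    equidistant⇒≡ | j , inj₂ d≡ with splitWalk j (suc j) (subst (Walk G u w) (trans d≡ (sym (+-suc j j))) (dist-walk u w))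
    ... | x , p , step x~y q = ⊥-elim (middle-edge⇒⊥ p x~y q (trans d≡ (sym (+-suc j j))))

  meetsLegPairs⇒resolving : ∀ S → MeetsLegPairs S → Resolving G S
  meetsLegPairs⇒resolving S meets u w u≢w with any? (λ h → (h ∈? S) ×-dec ¬? (dist u h ℕP.≟ dist w h))
  ... | yes (h , h∈S , d≢) = h , h∈S , dist u h , dist w h , dist-Dist u h , dist-Dist w h , d≢
  ... | no unresolved = ⊥-elim (u≢w (equidistant⇒≡ meets equidistant))
    where
    equidistant : Equidistant S u w
    equidistant h h∈S with dist u h ℕP.≟ dist w h
    ... | yes d≡ = d≡
    ... | no d≢ = ⊥-elim (unresolved (h , h∈S , d≢))

  Branch-transport : ∀ {v y t y′ a b k} → Walk (G -ᵛ v) a b k → Branch v y a → ¬ Branch v y t → Branch t y′ b → Branch t y′ a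
  Branch-transport here _ _ b∈ = b∈
  Branch-transport {v} {y} (step e q) a∈ t∉ b∈ =
    let (a~ , _ , ≢v) = adj-ᵛ⁻ e
        next∈ = Branch-step a∈ a~ ≢v
    in Branch-step (Branch-transport q next∈ t∉ b∈) (adj-sym _ _ a~) (λ a≡t → t∉ (subst (Branch v y) a≡t a∈))

  -- If v ≢ v′, one of them would lie in the other's leg, which has no vertex of degree ≥ 3.
  leg-unique : ∀ {v v′ y y′ x} → ExteriorMajor′ v → ExteriorMajor′ v′ → LegHead v y → LegHead v′ y′ →
               Branch v y x → Branch v′ y′ x → v ≡ v′ × y ≡ y′
  leg-unique {v} {v′} {y} {y′} major major′ (v~y , low) (v′~y′ , low′) x∈ x∈′ with v FP.≟ v′
  ... | yes refl with y FP.≟ y′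
  ...   | yes y≡y′ = refl , y≡y′
  ...   | no y≢y′ = ⊥-elim (Branch-disjoint v~y v′~y′ y≢y′ x∈ x∈′)
  leg-unique {v} {v′} {y} major major′ (v~y , low) (v′~y′ , low′) x∈ x∈′ | no v≢v′ with Branch? v y v′
  ... | yes v′∈ = ⊥-elim (low v′ v′∈ (proj₁ major′))
  ... | no v′∉ = ⊥-elim (low′ v (Branch-step (Branch-transport (proj₂ (proj₂ x∈)) (Branch-head v~y) v′∉ x∈′) (adj-sym _ _ v~y) v≢v′) (proj₁ major))

  WithinLegs OnePerLeg SparesLeg Admissible : Subset n → Set
  WithinLegs I = ∀ x → x ∈ I → ∃₂ λ v y → ExteriorMajor′ v × LegHead v y × Branch v y x
  OnePerLeg I = ∀ x x′ v y → x ∈ I → x′ ∈ I → ExteriorMajor′ v → LegHead v y → Branch v y x → Branch v y x′ → x ≡ x′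
  SparesLeg I = ∀ v → ExteriorMajor′ v → ∃ λ y → LegHead v y × Misses I v y
  Admissible I = WithinLegs I × OnePerLeg I × SparesLeg I

  opaque
    Misses? : ∀ I v y → Dec (Misses I v y)
    Misses? I v y = all? (λ z → Branch? v y z →-dec ¬? (z ∈? I))

    Admissible? : ∀ I → Dec (Admissible I)
    Admissible? I =
      all? (λ x → (x ∈? I) →-dec any? (λ v → any? (λ y → ExteriorMajor′? v ×-dec LegHead? v y ×-dec Branch? v y x)))
      ×-dec all? (λ x → all? (λ x′ → all? (λ v → all? (λ y → (x ∈? I) →-dec (x′ ∈? I) →-dec ExteriorMajor′? v →-dec
                   LegHead? v y →-dec Branch? v y x →-dec Branch? v y x′ →-dec (x FP.≟ x′)))))
      ×-dec all? (λ v → ExteriorMajor′? v →-dec any? (λ y → LegHead? v y ×-dec Misses? I v y))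

  Admissible-⊆ : ∀ {I R} → Admissible R → I ⊆ R → Admissible I
  Admissible-⊆ (within , onePer , spares) I⊆R =
    (λ x x∈ → within x (I⊆R x∈)) ,
    (λ x x′ v y x∈ x′∈ → onePer x x′ v y (I⊆R x∈) (I⊆R x′∈)) ,
    λ v major → let (y , head , misses) = spares v major in y , head , λ z z∈ z∈I → misses z z∈ (I⊆R z∈I)

  Admissible-⊥ : Admissible Subset.⊥
  Admissible-⊥ = (λ _ x∈ → ⊥-elim (∉⊥ x∈)) , (λ _ _ _ _ x∈ → ⊥-elim (∉⊥ x∈)) ,
                 λ v (_ , y , head) → y , head , λ _ _ → ∉⊥

  admissible-insert : ∀ {I v y x} → Admissible I → ExteriorMajor′ v → LegHead v y → Branch v y x → Misses I v y →
                      (∃ λ y′ → LegHead v y′ × y′ ≢ y × Misses I v y′) → Admissible (I ∪ ⁅ x ⁆)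
  admissible-insert {I} {v} {y} {x} (within , onePer , spares) major head x∈ missesY (y′ , head′ , y′≢y , missesY′) =
    within′ , onePer′ , spares′
    where
    x-leg : ∀ {v₁ y₁} → ExteriorMajor′ v₁ → LegHead v₁ y₁ → Branch v₁ y₁ x → v ≡ v₁ × y ≡ y₁
    x-leg major₁ head₁ x∈₁ = leg-unique major major₁ head head₁ x∈ x∈₁
    within′ : WithinLegs (I ∪ ⁅ x ⁆)
    within′ t t∈ with x∈p∪⁅y⁆⁻ I t∈
    ... | inj₁ t∈I = within t t∈I
    ... | inj₂ refl = v , y , major , head , x∈
    onePer′ : OnePerLeg (I ∪ ⁅ x ⁆)
    onePer′ t t′ v₁ y₁ t∈ t′∈ major₁ head₁ t∈₁ t′∈₁ with x∈p∪⁅y⁆⁻ I t∈ | x∈p∪⁅y⁆⁻ I t′∈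
    ... | inj₁ t∈I | inj₁ t′∈I = onePer t t′ v₁ y₁ t∈I t′∈I major₁ head₁ t∈₁ t′∈₁
    ... | inj₂ refl | inj₂ refl = refl
    ... | inj₁ t∈I | inj₂ refl with x-leg major₁ head₁ t′∈₁
    ...   | refl , refl = ⊥-elim (missesY t t∈₁ t∈I)
    onePer′ t t′ v₁ y₁ t∈ t′∈ major₁ head₁ t∈₁ t′∈₁ | inj₂ refl | inj₁ t′∈I with x-leg major₁ head₁ t∈₁
    ...   | refl , refl = ⊥-elim (missesY t′ t′∈₁ t′∈I)
    spares′ : SparesLeg (I ∪ ⁅ x ⁆)
    spares′ v₁ major₁ with v₁ FP.≟ v
    ... | yes refl = y′ , head′ , λ t t∈ t∈I∪x → [ missesY′ t t∈ , (λ { refl → Branch-disjoint (proj₁ head′) (proj₁ head) y′≢y t∈ x∈ }) ]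
                                                  (x∈p∪⁅y⁆⁻ I t∈I∪x)
    ... | no v₁≢v = let (y₁ , head₁ , misses₁) = spares v₁ major₁ in
      y₁ , head₁ , λ t t∈ t∈I∪x → [ misses₁ t t∈ , (λ { refl → v₁≢v (sym (proj₁ (x-leg major₁ head₁ t∈))) }) ] (x∈p∪⁅y⁆⁻ I t∈I∪x)

  Replaceable : Subset n → Fin n → Set
  Replaceable R x = ∀ v y₁ y₂ → LegPair v y₁ y₂ → Branch v y₁ x ⊎ Branch v y₂ x → MeetsLegPair (R - x) v y₁ y₂

  meetsLegPairs-remove : ∀ {R x} → MeetsLegPairs R → Replaceable R x → MeetsLegPairs (R - x)
  meetsLegPairs-remove {R} {x} meets replace v y₁ y₂ pair with meets v y₁ y₂ pair
  ... | z , z∈R , z∈legs with z FP.≟ x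
  ...   | yes refl = replace v y₁ y₂ pair z∈legs
  ...   | no z≢x = z , x∈p∧x≢y⇒x∈p-y z∈R z≢x , z∈legs

  minimalResolving⇒essential : ∀ {R x} → MinimalResolving G R → x ∈ R → ¬ MeetsLegPairs (R - x)
  minimalResolving⇒essential {R} {x} (_ , minimal) x∈R meets =
    minimal (R - x) (x∈p-y⇒x∈p , x , x∈R , λ x∈ → x∈p-y⇒x≢y x∈ refl) (meetsLegPairs⇒resolving _ meets)

  minimalResolving⇒irreplaceable : ∀ {R x} → MinimalResolving G R → x ∈ R → ¬ Replaceable R x
  minimalResolving⇒irreplaceable minRes x∈R replace =
    minimalResolving⇒essential minRes x∈R (meetsLegPairs-remove (resolving⇒meetsLegPairs _ (proj₁ minRes)) replace)

  minimalResolving⇒withinLegs : ∀ {R} → MinimalResolving G R → WithinLegs R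
  minimalResolving⇒withinLegs minRes x x∈R
    with any? (λ v → any? (λ y → ExteriorMajor′? v ×-dec LegHead? v y ×-dec Branch? v y x))
  ... | yes inLeg = inLeg
  ... | no notInLeg = ⊥-elim (minimalResolving⇒irreplaceable minRes x∈R
        λ v y₁ y₂ (major , head₁ , head₂ , _) x∈legs →
          ⊥-elim (notInLeg (v , [ (λ x∈ → y₁ , major , head₁ , x∈) , (λ x∈ → y₂ , major , head₂ , x∈) ] x∈legs)))

  minimalResolving⇒onePerLeg : ∀ {R} → MinimalResolving G R → OnePerLeg R
  minimalResolving⇒onePerLeg {R} minRes x x′ v y x∈R x′∈R major head x∈ x′∈ with x FP.≟ x′
  ... | yes x≡x′ = x≡x′
  ... | no x≢x′ = ⊥-elim (minimalResolving⇒irreplaceable minRes x∈R replace)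
    where
    x′∈R-x : x′ ∈ R - x
    x′∈R-x = x∈p∧x≢y⇒x∈p-y x′∈R (≢-sym x≢x′)
    replace : Replaceable R x
    replace v₁ y₁ y₂ (major₁ , head₁ , head₂ , _) (inj₁ x∈₁) with leg-unique major major₁ head head₁ x∈ x∈₁
    ... | refl , refl = x′ , x′∈R-x , inj₁ x′∈
    replace v₁ y₁ y₂ (major₁ , head₁ , head₂ , _) (inj₂ x∈₂) with leg-unique major major₁ head head₂ x∈ x∈₂
    ... | refl , refl = x′ , x′∈R-x , inj₂ x′∈

  -- If R met every leg at v, the vertex of R on one leg could be dropped.
  minimalResolving⇒sparesLeg : ∀ {R} → MinimalResolving G R → SparesLeg R
  minimalResolving⇒sparesLeg {R} minRes v major with any? (λ y → LegHead? v y ×-dec Misses? R v y)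
  ... | yes spared = spared
  ... | no noneSpared = ⊥-elim (minimalResolving⇒irreplaceable minRes x∈R replace)
    where
    hit : ∀ y → LegHead v y → ∃ λ z → z ∈ R × Branch v y z
    hit y head with any? (λ z → (z ∈? R) ×-dec Branch? v y z)
    ... | yes z = z
    ... | no none = ⊥-elim (noneSpared (y , head , λ z z∈ z∈R → none (z , z∈R , z∈)))
    y₀ = proj₁ (proj₂ major)
    head₀ = proj₂ (proj₂ major)
    x = proj₁ (hit y₀ head₀)
    x∈R = proj₁ (proj₂ (hit y₀ head₀))
    x∈ = proj₂ (proj₂ (hit y₀ head₀))
    other : ∀ y → LegHead v y → y₀ ≢ y → ∃ λ z → z ∈ R - x × Branch v y z
    other y head y₀≢y with hit y head
    ... | z , z∈R , z∈ = z , x∈p∧x≢y⇒x∈p-y z∈R (λ { refl → Branch-disjoint (proj₁ head₀) (proj₁ head) y₀≢y x∈ z∈ }) , z∈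
    replace : Replaceable R x
    replace v₁ y₁ y₂ (major₁ , head₁ , head₂ , y₁≢y₂) (inj₁ x∈₁) with leg-unique major major₁ head₀ head₁ x∈ x∈₁
    ... | refl , refl = let (z , z∈ , z∈₂) = other y₂ head₂ y₁≢y₂ in z , z∈ , inj₂ z∈₂
    replace v₁ y₁ y₂ (major₁ , head₁ , head₂ , y₁≢y₂) (inj₂ x∈₂) with leg-unique major major₁ head₀ head₂ x∈ x∈₂
    ... | refl , refl = let (z , z∈ , z∈₁) = other y₁ head₁ (≢-sym y₁≢y₂) in z , z∈ , inj₁ z∈₁

  minimalResolving⇒admissible : ∀ {R} → MinimalResolving G R → Admissible R
  minimalResolving⇒admissible minRes =
    minimalResolving⇒withinLegs minRes , minimalResolving⇒onePerLeg minRes , minimalResolving⇒sparesLeg minRes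

  opaque
    spared : Subset n → Fin n → Fin n
    spared I v with any? (λ y → LegHead? v y ×-dec Misses? I v y)
    ... | yes (y , _) = y
    ... | no _ = v

    spared-spec : ∀ {I v} → SparesLeg I → ExteriorMajor′ v → LegHead v (spared I v) × Misses I v (spared I v)
    spared-spec {I} {v} spares major with any? (λ y → LegHead? v y ×-dec Misses? I v y)
    ... | yes (_ , spec) = spec
    ... | no none = ⊥-elim (none (spares v major))

  -- Completing I: add the head of every leg that I misses, except one spared leg at each exterior major vertex.
  module Completion {I : Subset n} (admissible : Admissible I) where

    private
      within = proj₁ admissible
      onePer = proj₁ (proj₂ admissible)
      spares = proj₂ (proj₂ admissible)

    ExtraHead : Fin n → Set
    ExtraHead z = ∃ λ v → ExteriorMajor′ v × LegHead v z × z ≢ spared I v × Misses I v z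

    InCompletion : Fin n → Set
    InCompletion z = z ∈ I ⊎ ExtraHead z

    InCompletion? : ∀ z → Dec (InCompletion z)
    InCompletion? z = (z ∈? I) ⊎-dec any? (λ v → ExteriorMajor′? v ×-dec LegHead? v z ×-dec ¬? (z FP.≟ spared I v) ×-dec Misses? I v z)

    R : Subset n
    R = ⟦ InCompletion? ⟧

    I⊆R : I ⊆ R
    I⊆R x∈I = ∈⟦⟧⁺ InCompletion? (inj₁ x∈I)

    meetsLegPair : ∀ v y₁ y₂ y → ExteriorMajor′ v → LegHead v y → y ≢ spared I v →
                   (∀ {z} → Branch v y z → Branch v y₁ z ⊎ Branch v y₂ z) → MeetsLegPair R v y₁ y₂
    meetsLegPair v y₁ y₂ y major head y≢spared ⊆legs with any? (λ t → (t ∈? I) ×-dec Branch? v y t)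
    ... | yes (t , t∈I , t∈) = t , I⊆R t∈I , ⊆legs t∈
    ... | no missed = y , ∈⟦⟧⁺ InCompletion? (inj₂ (v , major , head , y≢spared , λ t t∈ t∈I → missed (t , t∈I , t∈))) ,
                      ⊆legs (Branch-head (proj₁ head))

    meets : MeetsLegPairs R
    meets v y₁ y₂ (major , head₁ , head₂ , y₁≢y₂) with y₁ FP.≟ spared I v
    ... | no y₁≢spared = meetsLegPair v y₁ y₂ y₁ major head₁ y₁≢spared inj₁
    ... | yes y₁≡spared = meetsLegPair v y₁ y₂ y₂ major head₂ (λ y₂≡spared → y₁≢y₂ (trans y₁≡spared (sym y₂≡spared))) inj₂

    R-misses-spared : ∀ v → ExteriorMajor′ v → Misses R v (spared I v)
    R-misses-spared v major t t∈ t∈R with ∈⟦⟧⁻ InCompletion? t∈R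
    ... | inj₁ t∈I = proj₂ (spared-spec spares major) t t∈ t∈I
    ... | inj₂ (v′ , major′ , head′ , t≢spared , _) with leg-unique major′ major head′ (proj₁ (spared-spec spares major)) (Branch-head (proj₁ head′)) t∈
    ... | refl , t≡spared = t≢spared t≡spared

    Sole : Fin n → Set
    Sole z = ∃₂ λ v y → ExteriorMajor′ v × LegHead v y × y ≢ spared I v × (∀ t → t ∈ R → Branch v y t → t ≡ z)

    sole : ∀ z → z ∈ R → Sole z
    sole z z∈R with ∈⟦⟧⁻ InCompletion? z∈R
    ... | inj₁ z∈I = let (v , y , major , head , z∈) = within z z∈I in
        v , y , major , head , (λ y≡spared → proj₂ (spared-spec spares major) z (subst (λ q → Branch v q z) y≡spared z∈) z∈I) , only
      where
      only : ∀ t → t ∈ R → Branch _ _ t → t ≡ z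
      only t t∈R t∈ with ∈⟦⟧⁻ InCompletion? t∈R
      ... | inj₁ t∈I = onePer t z _ _ t∈I z∈I (proj₁ (proj₂ (proj₂ (within z z∈I)))) (proj₁ (proj₂ (proj₂ (proj₂ (within z z∈I))))) t∈
                         (proj₂ (proj₂ (proj₂ (proj₂ (within z z∈I)))))
      ... | inj₂ (v′ , major′ , head′ , _ , misses′) with leg-unique major′ (proj₁ (proj₂ (proj₂ (within z z∈I)))) head′
                                                             (proj₁ (proj₂ (proj₂ (proj₂ (within z z∈I))))) (Branch-head (proj₁ head′)) t∈
      ... | refl , refl = ⊥-elim (misses′ z (proj₂ (proj₂ (proj₂ (proj₂ (within z z∈I))))) z∈I)
    ... | inj₂ (v , major , head , z≢spared , misses) = v , z , major , head , z≢spared , only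
      where
      only : ∀ t → t ∈ R → Branch v z t → t ≡ z
      only t t∈R t∈ with ∈⟦⟧⁻ InCompletion? t∈R
      ... | inj₁ t∈I = ⊥-elim (misses t t∈ t∈I)
      ... | inj₂ (v′ , major′ , head′ , _ , _) with leg-unique major′ major head′ head (Branch-head (proj₁ head′)) t∈
      ... | refl , t≡z = t≡z

    minimal : ∀ S → S ⊂ R → ¬ Resolving G S
    minimal S (S⊆R , z , z∈R , z∉S) resolving with sole z z∈R
    ... | v , y , major , head , y≢spared , only
      with resolving⇒meetsLegPairs S resolving v y (spared I v) (major , head , proj₁ (spared-spec spares major) , y≢spared)
    ... | s , s∈S , inj₁ s∈ = z∉S (subst (_∈ S) (only s (S⊆R s∈S) s∈) s∈S)
    ... | s , s∈S , inj₂ s∈ = R-misses-spared v major s s∈ (S⊆R s∈S)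

    minimalResolving : MinimalResolving G R
    minimalResolving = meetsLegPairs⇒resolving R meets , minimal

  opaque
    independent⇒admissible : ∀ {I} → Independent G I → Admissible I
    independent⇒admissible (R , minRes , I⊆R) = Admissible-⊆ (minimalResolving⇒admissible minRes) I⊆R

    admissible⇒independent : ∀ {I} → Admissible I → Independent G I
    admissible⇒independent admissible = R , minimalResolving , I⊆R
      where open Completion admissible

  Independent? : ∀ I → Dec (Independent G I)
  Independent? I = map′ admissible⇒independent independent⇒admissible (Admissible? I)

  opaque
    rank-exists : ∀ X → ∃ (Rank G X)
    rank-exists X with largest n noneAbove
      where
      OfSize : ℕ → Set
      OfSize k = ∃ λ I → I ⊆ X × Independent G I × ∣ I ∣ ≡ k
      OfSize? : ∀ k → Dec (OfSize k)
      OfSize? k = anySubset? (λ I → (I ⊆? X) ×-dec Independent? I ×-dec (∣ I ∣ ℕP.≟ k))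
      largest : ∀ k → (∀ j → k < j → ¬ OfSize j) → ∃ λ r → OfSize r × (∀ j → OfSize j → j ≤ r)
      largest k noneAbove with OfSize? k
      ... | yes ofSize = k , ofSize , λ j ofSizeJ → ℕP.≮⇒≥ (λ k<j → noneAbove j k<j ofSizeJ)
      largest zero noneAbove | no ¬ofSize =
        ⊥-elim (¬ofSize (Subset.⊥ , (λ x∈ → ⊥-elim (∉⊥ x∈)) , admissible⇒independent Admissible-⊥ , ∣⊥∣≡0 n))
      largest (suc k) noneAbove | no ¬ofSize = largest k λ j k<j ofSizeJ →
        [ (λ 1+k<j → noneAbove j 1+k<j ofSizeJ) , (λ { refl → ¬ofSize ofSizeJ }) ] (ℕP.m≤n⇒m<n∨m≡n k<j)
      noneAbove : ∀ j → n < j → ¬ OfSize j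
      noneAbove j n<j (I , _ , _ , ∣I∣≡j) = ℕP.<⇒≱ n<j (subst (_≤ n) ∣I∣≡j (∣p∣≤n I))
    ... | r , (I , I⊆X , independent , ∣I∣≡r) , maximal =
      r , (I , I⊆X , independent , ∣I∣≡r) , λ J J⊆X independentJ → maximal _ (J , J⊆X , independentJ , refl)

  rank-unique : ∀ {X r s} → Rank G X r → Rank G X s → r ≡ s
  rank-unique ((I , I⊆X , independentI , ∣I∣≡r) , maxR) ((J , J⊆X , independentJ , ∣J∣≡s) , maxS) =
    ≤-antisym (subst (_≤ _) ∣I∣≡r (maxS I I⊆X independentI)) (subst (_≤ _) ∣J∣≡s (maxR J J⊆X independentJ))

  admissible-exchange : ∀ {I v y w x z} → Admissible I → x ∈ I → ExteriorMajor′ v → LegHead v y → Branch v y x →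
                        LegHead v w → Branch v w z → (w ≡ y ⊎ Misses I v w) →
                        Admissible ((I - x) ∪ ⁅ z ⁆) × ∣ (I - x) ∪ ⁅ z ⁆ ∣ ≡ ∣ I ∣
  admissible-exchange {I} {v} {y} {w} {x} {z} admissible@(_ , onePer , spares) x∈I major headY x∈ headW z∈ w≡y⊎misses =
    admissible-insert (Admissible-⊆ admissible x∈p-y⇒x∈p) major headW z∈ missesW other ,
    trans (x∉p⇒∣p∪⁅x⁆∣≡1+∣p∣ (missesW z z∈)) (sym (x∈p⇒∣p∣≡1+∣p-x∣ x∈I))
    where
    onlyX : ∀ t → t ∈ I → Branch v y t → t ≡ x
    onlyX t t∈I t∈ = onePer t x v y t∈I x∈I major headY t∈ x∈
    weaken : ∀ {u} → Misses I v u → Misses (I - x) v u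
    weaken misses t t∈ t∈I-x = misses t t∈ (x∈p-y⇒x∈p t∈I-x)
    missesY : Misses (I - x) v y
    missesY t t∈ t∈I-x = x∈p-y⇒x≢y t∈I-x (onlyX t (x∈p-y⇒x∈p t∈I-x) t∈)
    missesW : Misses (I - x) v w
    missesW = [ (λ { refl → missesY }) , weaken ] w≡y⊎misses
    other : ∃ λ y′ → LegHead v y′ × y′ ≢ w × Misses (I - x) v y′
    other = [ sameLeg , (λ missesI → y , headY , (λ { refl → missesI x x∈ x∈I }) , missesY) ] w≡y⊎misses
      where
      sameLeg : w ≡ y → ∃ λ y′ → LegHead v y′ × y′ ≢ w × Misses (I - x) v y′
      sameLeg refl = let (y′ , head′ , misses′) = spares v major in
        y′ , head′ , (λ { refl → misses′ x x∈ x∈I }) , weaken misses′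

  MissedLegPair : Subset n → Fin n → Fin n → Fin n → Set
  MissedLegPair H v y₁ y₂ = LegPair v y₁ y₂ × Misses H v y₁ × Misses H v y₂

  -- The basis of the complement of the legs at v with heads a and b: the heads of all other legs,
  -- omitting one spared leg at each exterior major vertex, namely the leg b at v.
  module LegPairBasis (v a b : Fin n) (major : ExteriorMajor′ v) (headA : LegHead v a) (headB : LegHead v b) (a≢b : a ≢ b) where

    opaque
      someHead : Fin n → Fin n
      someHead v′ with any? (LegHead? v′)
      ... | yes (y , _) = y
      ... | no _ = v′

      someHead-spec : ∀ {v′} → ExteriorMajor′ v′ → LegHead v′ (someHead v′)
      someHead-spec {v′} (_ , head) with any? (LegHead? v′)
      ... | yes (_ , head′) = head′
      ... | no none = ⊥-elim (none head)

    spared′ : Fin n → Fin n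
    spared′ v′ with v′ FP.≟ v
    ... | yes _ = b
    ... | no _ = someHead v′

    spared′-spec : ∀ {v′} → ExteriorMajor′ v′ → LegHead v′ (spared′ v′)
    spared′-spec {v′} major′ with v′ FP.≟ v
    ... | yes refl = headB
    ... | no _ = someHead-spec major′

    spared′-v : spared′ v ≡ b
    spared′-v with v FP.≟ v
    ... | yes _ = refl
    ... | no v≢v = ⊥-elim (v≢v refl)

    InBasis : Fin n → Set
    InBasis y = ∃ λ v′ → ExteriorMajor′ v′ × LegHead v′ y × y ≢ spared′ v′ × y ≢ a

    InBasis? : ∀ y → Dec (InBasis y)
    InBasis? y = any? (λ v′ → ExteriorMajor′? v′ ×-dec LegHead? v′ y ×-dec ¬? (y FP.≟ spared′ v′) ×-dec ¬? (y FP.≟ a))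

    basis : Subset n
    basis = ⟦ InBasis? ⟧

    a∉basis : a ∉ basis
    a∉basis a∈ = let (_ , _ , _ , _ , a≢a) = ∈⟦⟧⁻ InBasis? a∈ in a≢a refl

    basis-only-heads : ∀ {t v′ y} → t ∈ basis → ExteriorMajor′ v′ → LegHead v′ y → Branch v′ y t →
                       t ≡ y × y ≢ spared′ v′ × y ≢ a
    basis-only-heads t∈ major′ head′ t∈′ with ∈⟦⟧⁻ InBasis? t∈
    ... | _ , major″ , head″ , t≢spared , t≢a with leg-unique major″ major′ head″ head′ (Branch-head (proj₁ head″)) t∈′
    ... | refl , refl = refl , t≢spared , t≢a

    basis-misses : ∀ y → y ∈ basis → ¬ Branch v a y × ¬ Branch v b y
    basis-misses y y∈ = (λ y∈a → proj₂ (proj₂ (basis-only-heads y∈ major headA y∈a)) refl) ,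
                        (λ y∈b → proj₁ (proj₂ (basis-only-heads y∈ major headB y∈b)) (sym spared′-v))

    basis-admissible : Admissible basis
    basis-admissible =
      (λ y y∈ → let (v′ , major′ , head′ , _) = ∈⟦⟧⁻ InBasis? y∈ in v′ , y , major′ , head′ , Branch-head (proj₁ head′)) ,
      (λ t t′ v′ y t∈ t′∈ major′ head′ t∈′ t′∈′ →
         trans (proj₁ (basis-only-heads t∈ major′ head′ t∈′)) (sym (proj₁ (basis-only-heads t′∈ major′ head′ t′∈′)))) ,
      λ v′ major′ → spared′ v′ , spared′-spec major′ ,
        λ t t∈′ t∈ → proj₁ (proj₂ (basis-only-heads t∈ major′ (spared′-spec major′) t∈′)) refl

    basis∪⁅x⁆-admissible : ∀ {x} → Branch v a x → Admissible (basis ∪ ⁅ x ⁆)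
    basis∪⁅x⁆-admissible x∈ = admissible-insert basis-admissible major headA x∈
      (λ t t∈ t∈basis → proj₁ (basis-misses t t∈basis) t∈)
      (b , headB , ≢-sym a≢b , λ t t∈ t∈basis → proj₂ (basis-misses t t∈basis) t∈)

    -- Charge x ∈ I to the head of its leg, or, if that leg is the spared one, to the head of a leg I misses.
    Charge : Subset n → Fin n → Fin n → Set
    Charge I x t = ∃₂ λ v₁ y₁ → ExteriorMajor′ v₁ × LegHead v₁ y₁ × Branch v₁ y₁ x × LegHead v₁ t ×
                   (t ≡ y₁ ⊎ y₁ ≡ spared′ v₁ × Misses I v₁ t)

    opaque
      charge-injective : ∀ {I} → Admissible I → ∀ x x′ t → x ∈ I → x′ ∈ I → Charge I x t → Charge I x′ t → x ≡ x′
      charge-injective (_ , onePer , _) x x′ t x∈I x′∈I (v₁ , y₁ , major₁ , head₁ , x∈ , headT , how) (_ , _ , major₁′ , _ , x′∈ , headT′ , how′)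
        with leg-unique major₁ major₁′ headT headT′ (Branch-head (proj₁ headT)) (Branch-head (proj₁ headT′))
      ... | refl , _ with how | how′
      ... | inj₁ refl | inj₁ refl = onePer x x′ v₁ t x∈I x′∈I major₁ headT x∈ x′∈
      ... | inj₁ refl | inj₂ (_ , misses) = ⊥-elim (misses x x∈ x∈I)
      ... | inj₂ (_ , misses) | inj₁ refl = ⊥-elim (misses x′ x′∈ x′∈I)
      ... | inj₂ (y₁≡ , _) | inj₂ (y₁′≡ , _) = onePer x x′ v₁ y₁ x∈I x′∈I major₁ head₁ x∈ (subst (λ q → Branch v₁ q x′) (trans y₁′≡ (sym y₁≡)) x′∈)

      charge-exists : ∀ {I} → Admissible I → ∀ x → x ∈ I →
        ∃₂ λ t v₁ → ∃ λ y₁ → ExteriorMajor′ v₁ × LegHead v₁ t × t ≢ spared′ v₁ × Charge I x t ×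
                             Branch v₁ y₁ x × (t ≡ y₁ ⊎ y₁ ≡ spared′ v₁)
      charge-exists (within , _ , spares) x x∈I with within x x∈I
      ... | v₁ , y₁ , major₁ , head₁ , x∈ with y₁ FP.≟ spared′ v₁
      ... | no y₁≢spared = y₁ , v₁ , y₁ , major₁ , head₁ , y₁≢spared , (v₁ , y₁ , major₁ , head₁ , x∈ , head₁ , inj₁ refl) , x∈ , inj₁ refl
      ... | yes y₁≡spared with spares v₁ major₁
      ... | t , headT , misses =
        t , v₁ , y₁ , major₁ , headT , (λ t≡spared → misses x (subst (λ q → Branch v₁ q x) (trans y₁≡spared (sym t≡spared)) x∈) x∈I) ,
        (v₁ , y₁ , major₁ , head₁ , x∈ , headT , inj₂ (y₁≡spared , misses)) , x∈ , inj₂ y₁≡spared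

      ∣admissible∣≤ : ∀ {I} → Admissible I → ∣ I ∣ ≤ ∣ basis ∪ ⁅ a ⁆ ∣
      ∣admissible∣≤ {I} admissible = ∣p∣≤∣q∣-by-injection (Charge I) I (basis ∪ ⁅ a ⁆) into (charge-injective admissible)
        where
        into : ∀ x → x ∈ I → ∃ λ t → t ∈ basis ∪ ⁅ a ⁆ × Charge I x t
        into x x∈I with charge-exists admissible x x∈I
        ... | t , v₁ , _ , major₁ , headT , t≢spared , charge , _ with t FP.≟ a
        ... | yes refl = t , y∈p∪⁅y⁆ basis t , charge
        ... | no t≢a = t , x∈p⇒x∈p∪⁅y⁆ (∈⟦⟧⁺ InBasis? (v₁ , major₁ , headT , t≢spared , t≢a)) , charge

      ∣admissible-missing∣≤ : ∀ {I} → Admissible I → (∀ x → x ∈ I → ¬ Branch v a x × ¬ Branch v b x) → ∣ I ∣ ≤ ∣ basis ∣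
      ∣admissible-missing∣≤ {I} admissible avoids = ∣p∣≤∣q∣-by-injection (Charge I) I basis into (charge-injective admissible)
        where
        into : ∀ x → x ∈ I → ∃ λ t → t ∈ basis × Charge I x t
        into x x∈I with charge-exists admissible x x∈I
        ... | t , v₁ , y₁ , major₁ , headT , t≢spared , charge , x∈ , how with t FP.≟ a
        ... | no t≢a = t , ∈⟦⟧⁺ InBasis? (v₁ , major₁ , headT , t≢spared , t≢a) , charge
        ... | yes refl with leg-unique major major₁ headA headT (Branch-head (proj₁ headA)) (Branch-head (proj₁ headT))
        ... | refl , _ = ⊥-elim ([ (λ a≡y₁ → proj₁ (avoids x x∈I) (subst (λ q → Branch v q x) (sym a≡y₁) x∈)) ,
                                   (λ y₁≡spared → proj₂ (avoids x x∈I) (subst (λ q → Branch v q x) (trans y₁≡spared spared′-v) x∈)) ] how)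

    module _ (H : Subset n) (H-spec : ∀ z → z ∈ H ⇔ (¬ Branch v a z × ¬ Branch v b z)) where

      basis⊆H : basis ⊆ H
      basis⊆H {y} y∈ = from (H-spec y) (basis-misses y y∈)

      rank-H : Rank G H ∣ basis ∣
      rank-H = (basis , basis⊆H , admissible⇒independent basis-admissible , refl) ,
               λ I I⊆H independent → ∣admissible-missing∣≤ (independent⇒admissible independent) (λ x x∈I → to (H-spec x) (I⊆H x∈I))

      rank-⊤ : Rank G ⊤ (suc ∣ basis ∣)
      rank-⊤ = (basis ∪ ⁅ a ⁆ , (λ _ → ∈⊤) , admissible⇒independent (basis∪⁅x⁆-admissible (Branch-head (proj₁ headA))) ,
                x∉p⇒∣p∪⁅x⁆∣≡1+∣p∣ a∉basis) ,
               λ I _ independent → subst (∣ I ∣ ≤_) (x∉p⇒∣p∪⁅x⁆∣≡1+∣p∣ a∉basis) (∣admissible∣≤ (independent⇒admissible independent))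

      rank-H∪⁅x⁆ : ∀ x → Branch v a x → ∀ r s → Rank G H r → Rank G (H ∪ ⁅ x ⁆) s → r < s
      rank-H∪⁅x⁆ x x∈ r s rankH rankH∪x =
        subst (_< s) (rank-unique rank-H rankH)
          (subst (_≤ s) (x∉p⇒∣p∪⁅x⁆∣≡1+∣p∣ x∉basis)
             (proj₂ rankH∪x (basis ∪ ⁅ x ⁆) (λ z∈ → [ (λ z∈basis → x∈p⇒x∈p∪⁅y⁆ (basis⊆H z∈basis)) , (λ { refl → y∈p∪⁅y⁆ H x }) ]
                                                      (x∈p∪⁅y⁆⁻ basis z∈))
                       (admissible⇒independent (basis∪⁅x⁆-admissible x∈))))
        where
        x∉basis : x ∉ basis
        x∉basis x∈basis = proj₁ (basis-misses x x∈basis) x∈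

  legPair⇒hyperplane : ∀ {v X₁ X₂} → ExteriorMajor G v → Leg G v X₁ → Leg G v X₂ → X₁ ≢ X₂ → Hyperplane G (∁ (X₁ ∪ X₂))
  legPair⇒hyperplane {v} {X₁} {X₂} major leg₁ leg₂ X₁≢X₂ = flat , _ , rank-H H H-spec , rank-⊤ H H-spec
    where
    y₁ = LegFacts.p leg₁ zero
    y₂ = LegFacts.p leg₂ zero
    X₁≡ = proj₂ (Leg⇒LegHead leg₁)
    X₂≡ = proj₂ (Leg⇒LegHead leg₂)
    y₁≢y₂ : y₁ ≢ y₂
    y₁≢y₂ y₁≡y₂ = X₁≢X₂ (trans X₁≡ (trans (cong (branch v) y₁≡y₂) (sym X₂≡)))
    open LegPairBasis v y₁ y₂ (ExteriorMajor⇒′ major) (proj₁ (Leg⇒LegHead leg₁)) (proj₁ (Leg⇒LegHead leg₂)) y₁≢y₂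
    module Swapped = LegPairBasis v y₂ y₁ (ExteriorMajor⇒′ major) (proj₁ (Leg⇒LegHead leg₂)) (proj₁ (Leg⇒LegHead leg₁)) (≢-sym y₁≢y₂)
    H = ∁ (X₁ ∪ X₂)
    H-spec : ∀ z → z ∈ H ⇔ (¬ Branch v y₁ z × ¬ Branch v y₂ z)
    H-spec z = mk⇔
      (λ z∈H → (λ z∈ → x∈∁p⇒x∉p z∈H (x∈p∪q⁺ (inj₁ (subst (z ∈_) (sym X₁≡) (∈branch⁺ z∈))))) ,
               (λ z∈ → x∈∁p⇒x∉p z∈H (x∈p∪q⁺ (inj₂ (subst (z ∈_) (sym X₂≡) (∈branch⁺ z∈))))))
      (λ (z∉₁ , z∉₂) → x∉p⇒x∈∁p λ z∈ → [ (λ z∈₁ → z∉₁ (∈branch⁻ (subst (z ∈_) X₁≡ z∈₁))) ,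
                                          (λ z∈₂ → z∉₂ (∈branch⁻ (subst (z ∈_) X₂≡ z∈₂))) ] (x∈p∪q⁻ X₁ X₂ z∈))
    H-spec′ : ∀ z → z ∈ H ⇔ (¬ Branch v y₂ z × ¬ Branch v y₁ z)
    H-spec′ z = mk⇔ (λ z∈H → let (z∉₁ , z∉₂) = to (H-spec z) z∈H in z∉₂ , z∉₁) (λ (z∉₂ , z∉₁) → from (H-spec z) (z∉₁ , z∉₂))
    flat : Flat G H
    flat x x∉H r s rankH rankH∪x with Branch? v y₁ x | Branch? v y₂ x
    ... | yes x∈₁ | _ = rank-H∪⁅x⁆ H H-spec x x∈₁ r s rankH rankH∪x
    ... | no _ | yes x∈₂ = Swapped.rank-H∪⁅x⁆ H H-spec′ x x∈₂ r s rankH rankH∪x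
    ... | no x∉₁ | no x∉₂ = ⊥-elim (x∉H (from (H-spec x) (x∉₁ , x∉₂)))

  Misses-⊆ : ∀ {S T v y} → S ⊆ T → Misses T v y → Misses S v y
  Misses-⊆ S⊆T misses t t∈ t∈S = misses t t∈ (S⊆T t∈S)

  module FromHyperplane {H : Subset n} (hyperplane : Hyperplane G H) where

    private
      flat = proj₁ hyperplane
      r = proj₁ (proj₂ hyperplane)
      rank-H = proj₁ (proj₂ (proj₂ hyperplane))
      rank-⊤ = proj₂ (proj₂ (proj₂ hyperplane))

    -- A largest independent subset I of H ∪ ⁅ y ⁆ must contain y. Exchanging y for a vertex of H on
    -- the leg of y, or on a leg at the same vertex that I misses, would give an independent subset
    -- of H larger than its rank.
    outside⇒missedLegPair : ∀ y → y ∉ H → ∃₂ λ v y₁ → ∃ λ y₂ → MissedLegPair H v y₁ y₂ × Branch v y₁ y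
    outside⇒missedLegPair y y∉H with rank-exists H | rank-exists (H ∪ ⁅ y ⁆)
    ... | r₀ , rank₀ | s₀ , rank₁ with flat y y∉H r₀ s₀ rank₀ rank₁ | proj₁ rank₁
    ... | r₀<s₀ | I , I⊆ , independent , ∣I∣≡s₀ = result
      where
      admissible = independent⇒admissible independent
      ∈H : ∀ {t} → t ∈ I → t ≢ y → t ∈ H
      ∈H t∈I t≢y = [ id , (λ t≡y → ⊥-elim (t≢y t≡y)) ] (x∈p∪⁅y⁆⁻ H (I⊆ t∈I))
      y∈I : y ∈ I
      y∈I with y ∈? I
      ... | yes y∈I = y∈I
      ... | no y∉I = ⊥-elim (ℕP.<⇒≱ r₀<s₀ (subst (_≤ r₀) ∣I∣≡s₀ (proj₂ rank₀ I (λ t∈I → ∈H t∈I (λ { refl → y∉I t∈I })) independent)))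
      v = proj₁ (proj₁ admissible y y∈I)
      Y = proj₁ (proj₂ (proj₁ admissible y y∈I))
      major = proj₁ (proj₂ (proj₂ (proj₁ admissible y y∈I)))
      headY = proj₁ (proj₂ (proj₂ (proj₂ (proj₁ admissible y y∈I))))
      y∈ = proj₂ (proj₂ (proj₂ (proj₂ (proj₁ admissible y y∈I))))
      no-exchange : ∀ {w z} → LegHead v w → Branch v w z → z ∈ H → (w ≡ Y ⊎ Misses I v w) → ⊥
      no-exchange {w} {z} headW z∈ z∈H how with admissible-exchange admissible y∈I major headY y∈ headW z∈ how
      ... | admissible′ , ∣J∣≡∣I∣ =
        ℕP.<⇒≱ r₀<s₀ (subst (_≤ r₀) (trans ∣J∣≡∣I∣ ∣I∣≡s₀) (proj₂ rank₀ _ J⊆H (admissible⇒independent admissible′)))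
        where
        J⊆H : (I - y) ∪ ⁅ z ⁆ ⊆ H
        J⊆H t∈ = [ (λ t∈I-y → ∈H (x∈p-y⇒x∈p t∈I-y) (x∈p-y⇒x≢y t∈I-y)) , (λ { refl → z∈H }) ] (x∈p∪⁅y⁆⁻ (I - y) t∈)
      missesY : Misses H v Y
      missesY z z∈ z∈H = no-exchange headY z∈ z∈H (inj₁ refl)
      result : ∃₂ λ v y₁ → ∃ λ y₂ → MissedLegPair H v y₁ y₂ × Branch v y₁ y
      result with any? (λ Y′ → LegHead? v Y′ ×-dec ¬? (Y′ FP.≟ Y) ×-dec Misses? H v Y′)
      ... | yes (Y′ , headY′ , Y′≢Y , missesY′) = v , Y , Y′ , ((major , headY , headY′ , ≢-sym Y′≢Y) , missesY , missesY′) , y∈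
      ... | no noOther with proj₂ (proj₂ admissible) v major
      ... | Y′ , headY′ , missesI with any? (λ z → Branch? v Y′ z ×-dec (z ∈? H))
      ... | yes (z , z∈ , z∈H) = ⊥-elim (no-exchange headY′ z∈ z∈H (inj₂ missesI))
      ... | no none = ⊥-elim (noOther (Y′ , headY′ , (λ { refl → missesI y y∈ y∈I }) , λ z z∈ z∈H → none (z , z∈ , z∈H)))

    -- Two vertices outside H on different missed leg pairs extend a basis of H by two.
    two-outside⇒⊥ : ∀ {v y₁ y₂ x v′ z₁ z₂ z} → MissedLegPair H v y₁ y₂ → Branch v y₁ x →
                    MissedLegPair H v′ z₁ z₂ → Branch v′ z₁ z → ¬ Branch v y₁ z → ¬ Branch v y₂ z → ⊥
    two-outside⇒⊥ {v} {y₁} {y₂} {x} {v′} {z₁} {z₂} {z}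
      ((major , head₁ , head₂ , y₁≢y₂) , misses₁ , misses₂) x∈ ((major′ , headZ₁ , headZ₂ , z₁≢z₂) , missesZ₁ , missesZ₂) z∈ z∉₁ z∉₂ =
      ℕP.<⇒≱ (subst (suc r <_) (sym ∣J∣≡) ≤-refl) (proj₂ rank-⊤ J (λ _ → ∈⊤) (admissible⇒independent admissibleJ))
      where
      I = proj₁ (proj₁ rank-H)
      I⊆H = proj₁ (proj₂ (proj₁ rank-H))
      admissible = independent⇒admissible (proj₁ (proj₂ (proj₂ (proj₁ rank-H))))
      ∣I∣≡r = proj₂ (proj₂ (proj₂ (proj₁ rank-H)))
      J = (I ∪ ⁅ x ⁆) ∪ ⁅ z ⁆
      admissible₁ : Admissible (I ∪ ⁅ x ⁆)
      admissible₁ = admissible-insert admissible major head₁ x∈ (Misses-⊆ I⊆H misses₁)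
                      (y₂ , head₂ , ≢-sym y₁≢y₂ , Misses-⊆ I⊆H misses₂)
      x∉ : ∀ {u} → v ≢ u → ∀ {w} → LegHead u w → ExteriorMajor′ u → ¬ Branch u w x
      x∉ v≢u headW majorU x∈w = v≢u (proj₁ (leg-unique major majorU head₁ headW x∈ x∈w))
      other : ∃ λ w → LegHead v′ w × w ≢ z₁ × Misses (I ∪ ⁅ x ⁆) v′ w
      other with v′ FP.≟ v
      ... | yes refl = y₂ , head₂ , (λ { refl → z∉₂ z∈ }) ,
                       λ t t∈ t∈I∪x → [ Misses-⊆ I⊆H misses₂ t t∈ , (λ { refl → Branch-disjoint (proj₁ head₁) (proj₁ head₂) y₁≢y₂ x∈ t∈ }) ]
                                        (x∈p∪⁅y⁆⁻ I t∈I∪x)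
      ... | no v′≢v = z₂ , headZ₂ , ≢-sym z₁≢z₂ ,
                      λ t t∈ t∈I∪x → [ Misses-⊆ I⊆H missesZ₂ t t∈ , (λ { refl → x∉ (≢-sym v′≢v) headZ₂ major′ t∈ }) ] (x∈p∪⁅y⁆⁻ I t∈I∪x)
      missesZ₁′ : Misses (I ∪ ⁅ x ⁆) v′ z₁
      missesZ₁′ t t∈ t∈I∪x with x∈p∪⁅y⁆⁻ I t∈I∪x
      ... | inj₁ t∈I = missesZ₁ t t∈ (I⊆H t∈I)
      ... | inj₂ refl with leg-unique major major′ head₁ headZ₁ x∈ t∈
      ... | refl , refl = z∉₁ z∈
      admissibleJ : Admissible J
      admissibleJ = admissible-insert admissible₁ major′ headZ₁ z∈ missesZ₁′ other
      ∣J∣≡ : ∣ J ∣ ≡ suc (suc r)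
      ∣J∣≡ = trans (x∉p⇒∣p∪⁅x⁆∣≡1+∣p∣ (missesZ₁′ z z∈))
               (cong suc (trans (x∉p⇒∣p∪⁅x⁆∣≡1+∣p∣ (λ x∈I → misses₁ x x∈ (I⊆H x∈I))) (cong suc ∣I∣≡r)))

    hyperplane⇒legPair : ∃₂ λ v X₁ → ∃ λ X₂ → ExteriorMajor G v × Leg G v X₁ × Leg G v X₂ × X₁ ≢ X₂ × H ≡ ∁ (X₁ ∪ X₂)
    hyperplane⇒legPair with any? (λ x → ¬? (x ∈? H))
    ... | no noneOutside = ⊥-elim (ℕP.<⇒≱ (subst (r <_) (sym ∣I∣≡) ≤-refl) (proj₂ rank-H I (λ {t} _ → everything t) independent))
      where
      I = proj₁ (proj₁ rank-⊤)
      independent = proj₁ (proj₂ (proj₂ (proj₁ rank-⊤)))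
      ∣I∣≡ = proj₂ (proj₂ (proj₂ (proj₁ rank-⊤)))
      everything : ∀ t → t ∈ H
      everything t with t ∈? H
      ... | yes t∈H = t∈H
      ... | no t∉H = ⊥-elim (noneOutside (t , t∉H))
    ... | yes (x , x∉H) with outside⇒missedLegPair x x∉H
    ... | v , y₁ , y₂ , missed@((major , head₁ , head₂ , y₁≢y₂) , misses₁ , misses₂) , x∈ =
      v , branch v y₁ , branch v y₂ , ′⇒ExteriorMajor major , LegHead⇒Leg head₁ , LegHead⇒Leg head₂ , X₁≢X₂ ,
      ⊆-antisym H⊆ ⊆H
      where
      X₁≢X₂ : branch v y₁ ≢ branch v y₂
      X₁≢X₂ X₁≡X₂ = Branch-disjoint (proj₁ head₁) (proj₁ head₂) y₁≢y₂ (Branch-head (proj₁ head₁))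
                      (∈branch⁻ (subst (y₁ ∈_) X₁≡X₂ (∈branch⁺ (Branch-head (proj₁ head₁)))))
      H⊆ : H ⊆ ∁ (branch v y₁ ∪ branch v y₂)
      H⊆ {z} z∈H = x∉p⇒x∈∁p λ z∈ → [ (λ z∈₁ → misses₁ z (∈branch⁻ z∈₁) z∈H) , (λ z∈₂ → misses₂ z (∈branch⁻ z∈₂) z∈H) ]
                                     (x∈p∪q⁻ (branch v y₁) (branch v y₂) z∈)
      ⊆H : ∁ (branch v y₁ ∪ branch v y₂) ⊆ H
      ⊆H {z} z∈ with z ∈? H
      ... | yes z∈H = z∈H
      ... | no z∉H with outside⇒missedLegPair z z∉H
      ... | _ , _ , _ , missed′ , z∈′ = ⊥-elim (two-outside⇒⊥ missed x∈ missed′ z∈′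
             (λ z∈₁ → x∈∁p⇒x∉p z∈ (x∈p∪q⁺ (inj₁ (∈branch⁺ z∈₁)))) (λ z∈₂ → x∈∁p⇒x∉p z∈ (x∈p∪q⁺ (inj₂ (∈branch⁺ z∈₂)))))

theorem3 : (n : ℕ) → 4 ≤ n → (G : Graph n) → IsTree G → ¬ IsPathGraph G →
    (H : Subset n) →
    Hyperplane G H ⇔
      (∃ λ v → ∃ λ X₁ → ∃ λ X₂ → ExteriorMajor G v × Leg G v X₁ × Leg G v X₂ ×
         X₁ ≢ X₂ × H ≡ ∁ (X₁ ∪ X₂))
theorem3 n _ G (adj-sym , adj-irrefl , connected , acyclic) ¬path H = mk⇔ FromHyperplane.hyperplane⇒legPair
  λ { (v , X₁ , X₂ , major , leg₁ , leg₂ , X₁≢X₂ , refl) → legPair⇒hyperplane major leg₁ leg₂ X₁≢X₂ }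
  where open NonPathTree G adj-sym adj-irrefl connected acyclic ¬path
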